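{- Let $p\ge3$ be a prime. A minimal polynomial expression of $\max(x_0,x_1)$ on $\mathbb{F}_p{}^2$ is \[ \max(x_0,x_1)=(x_1-x_0)\sum_{d=2}^{p-2}d^{ -1}(x_0+1)(x_0+2)\cdots(x_0+d)\;x_1(x_1-1)\cdots(x_1-(p-d)+1) +x_0+(x_0+1)^2\bigl(1-(x_1+1)^{p-1}\bigr)+\bigl(1-x_0^{p-1}\bigr)x_1^2, \] where $d^{ -1}$ is the inverse of $d$ in $\mathbb{F}_p$ (and the sum is empty when $p=3$).
   Context: $\mathbb{F}_p$ is identified with $\{0,1,\dots,p-1\}$ with the usual ordering, and $\max(x_0,x_1)$ is the larger of $x_0,x_1$ in this ordering. A minimal polynomial expression is a polynomial over $\mathbb{F}_p$ of degree at most $p-1$ in each variable coinciding with the function on all of $\mathbb{F}_p{}^2$. -}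

module Defs where

open import Data.Nat using (ℕ; zero; suc; _+_; _∸_; _⊔_)
open import Data.Integer as ℤ using (ℤ; +_)
open import Data.List using (List; []; _∷_; map; foldr; upTo)

-- Syntactic polynomial expressions over ℤ in two variables x₀, x₁
-- (interpreted over 𝔽_p by evaluating in ℤ and reducing mod p).
data Poly : Set where
  X₀ X₁ : Poly
  con   : ℤ → Poly
  _⊕_   : Poly → Poly → Poly
  _⊗_   : Poly → Poly → Poly
  ⊖_    : Poly → Poly

infixl 6 _⊕_ _⊝_
infixl 7 _⊗_

_⊝_ : Poly → Poly → Poly
a ⊝ b = a ⊕ (⊖ b)

eval : ℤ → ℤ → Poly → ℤ
eval x y X₀ = x
eval x y X₁ = y
eval x y (con c) = c
eval x y (a ⊕ b) = eval x y a ℤ.+ eval x y b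
eval x y (a ⊗ b) = eval x y a ℤ.* eval x y b
eval x y (⊖ a) = ℤ.- eval x y a

-- syntactic upper bounds for the degree in x₀ and in x₁
deg₀ : Poly → ℕ
deg₀ X₀ = 1
deg₀ X₁ = 0
deg₀ (con _) = 0
deg₀ (a ⊕ b) = deg₀ a ⊔ deg₀ b
deg₀ (a ⊗ b) = deg₀ a + deg₀ b
deg₀ (⊖ a) = deg₀ a

deg₁ : Poly → ℕ
deg₁ X₀ = 0
deg₁ X₁ = 1
deg₁ (con _) = 0
deg₁ (a ⊕ b) = deg₁ a ⊔ deg₁ b
deg₁ (a ⊗ b) = deg₁ a + deg₁ b
deg₁ (⊖ a) = deg₁ a

ı : ℕ → Poly
ı n = con (+ n)

_^^_ : Poly → ℕ → Poly
a ^^ zero = ı 1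
a ^^ suc n = a ⊗ (a ^^ n)

ΣP : List Poly → Poly
ΣP = foldr _⊕_ (ı 0)

ΠP : List Poly → Poly
ΠP = foldr _⊗_ (ı 1)

-- [a, a+1, …, b]  (empty if b < a)
range : ℕ → ℕ → List ℕ
range a b = map (λ i → a + i) (upTo (suc b ∸ a))

-- The right-hand side of Theorem 5.5, with inv d standing for d⁻¹ ∈ 𝔽_p.
maxPoly : ℕ → (ℕ → ℤ) → Poly
maxPoly p inv =
    (X₁ ⊝ X₀) ⊗ ΣP (map term (range 2 (p ∸ 2)))
  ⊕ X₀
  ⊕ ((X₀ ⊕ ı 1) ^^ 2) ⊗ (ı 1 ⊝ ((X₁ ⊕ ı 1) ^^ (p ∸ 1)))
  ⊕ (ı 1 ⊝ (X₀ ^^ (p ∸ 1))) ⊗ (X₁ ^^ 2)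
  where
  term : ℕ → Poly
  term d = con (inv d)
         ⊗ ΠP (map (λ i → X₀ ⊕ ı i) (range 1 d))
         ⊗ ΠP (map (λ i → X₁ ⊝ ı i) (upTo (p ∸ d)))

module Submission where

open import Defs
open import Data.Nat using (ℕ; _≤_; _<_; _∸_; _⊔_)
open import Data.Nat.Primality using (Prime)
open import Data.Integer as ℤ using (ℤ; +_; _-_)
open import Data.Integer.Divisibility using (_∣_)
open import Data.Product using (_×_)

import Data.Integer.Properties as ℤP
open import Algebra.Bundles using (CommutativeMonoid; CommutativeSemiring; CommutativeRing)
open import Algebra.Structures using (IsCommutativeRing)
open import Algebra.Definitions.RawMonoid ℤ.+-0-rawMonoid using () renaming (_×_ to _×ᴿ_)
open import Algebra.Definitions.RawSemiring ℤ.+-*-rawSemiring using () renaming (_^_ to _^ᴿ_)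
open import Algebra.Properties.Monoid.Sum ℤP.+-0-monoid using () renaming (sum to ∑ᶠ)
open import Data.Empty using (⊥-elim)
open import Data.Fin using (toℕ)
import Data.Integer.DivMod as ℤ
open import Data.Integer.Divisibility.Signed as Signed using () renaming (_∣_ to _∣ₛ_)
open import Data.Integer.Tactic.RingSolver using (solve-∀)
open import Data.List using (map; applyUpTo; upTo)
open import Data.List.Properties using (map-applyUpTo)
open import Data.Nat as ℕ using (zero; suc; z≤n; s≤s; _!)
open import Data.Nat.Combinatorics using (_C_; nCk+nC[k+1]≡[n+1]C[k+1]; nC1≡n; nCn≡1)
import Data.Nat.Divisibility as ℕ
open import Data.Nat.Primality using (euclidsLemma)
import Data.Nat.Properties as ℕP
open import Data.Product using (_,_; proj₁; proj₂)
open import Data.Sum using (_⊎_; inj₁; inj₂; [_,_]′)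
open import Function using (_∘_; id)
open import Level using (0ℓ)
open import Relation.Binary.Definitions using (Tri; tri<; tri≈; tri>)
open import Relation.Binary.PropositionalEquality as ≡ using (_≡_; _≢_)
open import Relation.Nullary using (¬_; Dec; yes; no; _×-dec_)

import Algebra.Properties.CommutativeSemiring.Binomial ℤP.+-*-commutativeSemiring as Binomial

-- Write p = n + 2 and extend the inverses by 1⁻¹ = 1 and (p − 1)⁻¹ = −1.
-- Adding the two missing summands d = 1 and d = p − 1 to the sum of the theorem gives
--   S(x, y) = Σ_{d+e=n} (d+1)⁻¹ (x+1)⋯(x+d+1) · y(y−1)⋯(y−e).
-- Pascal's rule for the rising and falling factorials shows S(x, y+1) − S(x, y) ≡ −R(x, y) mod p,
-- where R(a, b) = Σ_{d+e=p−1} (a+1)⋯(a+d) · b(b−1)⋯(b−e+1) satisfies R(a+1, b+1) ≡ R(a, b).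
-- Thus R(a, b) is (p − 1)! ≡ −1 on the diagonal and 0 off it, and S(x, y) ≡ [x < y].
-- The remaining terms of the formula cancel the two added summands (by Fermat and Wilson),
-- leaving x + (y − x)[x < y] = max(x, y).

-- Finite sums and products

big : ∀ {a} {A : Set a} → (A → A → A) → A → ℕ → (ℕ → A) → A
big _∙_ ε zero    f = ε
big _∙_ ε (suc k) f = f 0 ∙ big _∙_ ε k (f ∘ suc)

module FoldProperties {c ℓ} (M : CommutativeMonoid c ℓ) where
  open CommutativeMonoid M
  open import Relation.Binary.Reasoning.Setoid setoid
  open import Algebra.Properties.CommutativeSemigroup commutativeSemigroup using (interchange)

  ⨁ : ℕ → (ℕ → Carrier) → Carrier
  ⨁ = big _∙_ ε

  cong-< : ∀ k {f g} → (∀ i → i < k → f i ≈ g i) → ⨁ k f ≈ ⨁ k g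
  cong-< zero    f≈g = refl
  cong-< (suc k) f≈g = ∙-cong (f≈g 0 (s≤s z≤n)) (cong-< k (λ i i<k → f≈g (suc i) (s≤s i<k)))

  snoc : ∀ k f → ⨁ (suc k) f ≈ ⨁ k f ∙ f k
  snoc zero    f = trans (identityʳ (f 0)) (sym (identityˡ (f 0)))
  snoc (suc k) f = trans (∙-congˡ (snoc k (f ∘ suc))) (sym (assoc (f 0) _ _))

  distrib : ∀ k f g → ⨁ k (λ i → f i ∙ g i) ≈ ⨁ k f ∙ ⨁ k g
  distrib zero    f g = sym (identityˡ ε)
  distrib (suc k) f g = trans (∙-congˡ (distrib k (f ∘ suc) (g ∘ suc))) (interchange (f 0) (g 0) _ _)

  trivial : ∀ k {f} → (∀ i → i < k → f i ≈ ε) → ⨁ k f ≈ ε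
  trivial k {f} f≈ε = trans (cong-< k f≈ε) (⨁-ε k)
    where
    ⨁-ε : ∀ k → ⨁ k (λ _ → ε) ≈ ε
    ⨁-ε zero    = refl
    ⨁-ε (suc k) = trans (identityˡ _) (⨁-ε k)

  single : ∀ k {f} j {v} → j < k → f j ≈ v → (∀ i → i < k → i ≢ j → f i ≈ ε) → ⨁ k f ≈ v
  single (suc k) {f} j {v} (s≤s j≤k) fj≈v others with j ℕ.≟ k
  ... | yes ≡.refl = begin
    ⨁ (suc k) f  ≈⟨ snoc k f ⟩
    ⨁ k f ∙ f k  ≈⟨ ∙-cong (trivial k (λ i i<k → others i (ℕP.m≤n⇒m≤1+n i<k) (ℕP.<⇒≢ i<k))) fj≈v ⟩
    ε ∙ v        ≈⟨ identityˡ v ⟩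
    v            ∎
  ... | no j≢k = begin
    ⨁ (suc k) f  ≈⟨ snoc k f ⟩
    ⨁ k f ∙ f k  ≈⟨ ∙-cong (single k j (ℕP.≤∧≢⇒< j≤k j≢k) fj≈v (λ i i<k → others i (ℕP.m≤n⇒m≤1+n i<k)))
                           (others k ℕP.≤-refl (j≢k ∘ ≡.sym)) ⟩
    v ∙ ε        ≈⟨ identityʳ v ⟩
    v            ∎

module SumProductProperties {c ℓ} (R : CommutativeSemiring c ℓ) where
  open CommutativeSemiring R
  open import Relation.Binary.Reasoning.Setoid setoid

  module ∑ = FoldProperties +-commutativeMonoid
  module ∏ = FoldProperties *-commutativeMonoid

  ∑-*ˡ : ∀ k x f → ∑.⨁ k (λ i → x * f i) ≈ x * ∑.⨁ k f
  ∑-*ˡ zero    x f = sym (zeroʳ x)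
  ∑-*ˡ (suc k) x f = trans (+-congˡ (∑-*ˡ k x (f ∘ suc))) (sym (distribˡ x (f 0) _))

  ∏-zero : ∀ k {f} j → j < k → f j ≈ 0# → ∏.⨁ k f ≈ 0#
  ∏-zero (suc k) {f} zero    _         f0≈0 = trans (*-congʳ f0≈0) (zeroˡ _)
  ∏-zero (suc k) {f} (suc j) (s≤s j<k) fj≈0 = trans (*-congˡ (∏-zero k j j<k fj≈0)) (zeroʳ (f 0))

  ∑⁺ : ℕ → (ℕ → ℕ → Carrier) → Carrier
  ∑⁺ n g = ∑.⨁ (suc n) (λ d → g d (n ∸ d))

  ∑⁺-cong : ∀ n {g h} → (∀ d e → d ℕ.+ e ≡ n → g d e ≈ h d e) → ∑⁺ n g ≈ ∑⁺ n h
  ∑⁺-cong n g≈h = ∑.cong-< (suc n) (λ d d<1+n → g≈h d (n ∸ d) (ℕP.m+[n∸m]≡n (ℕP.≤-pred d<1+n)))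

  ∑⁺-last : ∀ n g → ∑⁺ (suc n) g ≈ ∑⁺ n (λ d e → g d (suc e)) + g (suc n) 0
  ∑⁺-last n g = begin
    ∑⁺ (suc n) g                                             ≈⟨ ∑.snoc (suc n) (λ d → g d (suc n ∸ d)) ⟩
    ∑.⨁ (suc n) (λ d → g d (suc n ∸ d)) + g (suc n) (n ∸ n)  ≈⟨ +-cong shift (reflexive (≡.cong (g (suc n)) (ℕP.n∸n≡0 n))) ⟩
    ∑⁺ n (λ d e → g d (suc e)) + g (suc n) 0                 ∎
    where
    shift : ∑.⨁ (suc n) (λ d → g d (suc n ∸ d)) ≈ ∑⁺ n (λ d e → g d (suc e))
    shift = ∑.cong-< (suc n) (λ d d<1+n → reflexive (≡.cong (g d) (ℕP.+-∸-assoc 1 (ℕP.≤-pred d<1+n))))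

-- imported only now: the bundles opened above have their own _+_ and _*_
open import Data.Integer using (_+_; _*_; -_; _^_; 0ℤ; 1ℤ; -1ℤ)

∑< ∏< : ℕ → (ℕ → ℤ) → ℤ
∑< = big _+_ 0ℤ
∏< = big _*_ 1ℤ

infix 5 ∑< ∏<
syntax ∑< k (λ i → e) = ∑[ i < k ] e
syntax ∏< k (λ i → e) = ∏[ i < k ] e

open SumProductProperties ℤP.+-*-commutativeSemiring

pos-suc : ∀ n → + suc n ≡ + n + 1ℤ
pos-suc n = ≡.trans (ℤP.pos-+ 1 n) (ℤP.+-comm 1ℤ (+ n))

+[n!]≡∏ : ∀ n → + (n !) ≡ ∏[ i < n ] + suc i
+[n!]≡∏ zero    = ≡.refl
+[n!]≡∏ (suc n) = begin
  + (suc n ℕ.* n !)                ≡⟨ ℤP.pos-* (suc n) (n !) ⟩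
  + suc n * + (n !)                ≡⟨ ℤP.*-comm (+ suc n) _ ⟩
  + (n !) * + suc n                ≡⟨ ≡.cong (_* + suc n) (+[n!]≡∏ n) ⟩
  (∏[ i < n ] + suc i) * + suc n   ≡⟨ ∏.snoc n (λ i → + suc i) ⟨
  ∏[ i < suc n ] + suc i           ∎
  where open ≡.≡-Reasoning

-- Congruence modulo an integer

module Modulo (P : ℤ) where

  infix 4 _≈_
  record _≈_ (x y : ℤ) : Set where
    constructor mod
    field divides : P ∣ₛ x - y
  open _≈_ public

  private
    x-x≡0 : ∀ x → x - x ≡ 0ℤ
    x-x≡0 = solve-∀
    -[x-y]≡y-x : ∀ x y → - (x - y) ≡ y - x
    -[x-y]≡y-x = solve-∀
    [x-y]+[y-z]≡x-z : ∀ x y z → (x - y) + (y - z) ≡ x - z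
    [x-y]+[y-z]≡x-z = solve-∀
    [x-y]+[u-v]≡[x+u]-[y+v] : ∀ x y u v → (x - y) + (u - v) ≡ (x + u) - (y + v)
    [x-y]+[u-v]≡[x+u]-[y+v] = solve-∀
    x[u-v]+[x-y]v≡xu-yv : ∀ x y u v → x * (u - v) + (x - y) * v ≡ x * u - y * v
    x[u-v]+[x-y]v≡xu-yv = solve-∀
    -[x-y]≡[-x]-[-y] : ∀ x y → - (x - y) ≡ - x - - y
    -[x-y]≡[-x]-[-y] = solve-∀
    x-0≡x : ∀ x → x - 0ℤ ≡ x
    x-0≡x = solve-∀

  ∣⇒≈0 : ∀ {x} → P ∣ₛ x → x ≈ 0ℤ
  ∣⇒≈0 {x} P∣x = mod (≡.subst (P ∣ₛ_) (≡.sym (x-0≡x x)) P∣x)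

  ≈0⇒∣ : ∀ {x} → x ≈ 0ℤ → P ∣ₛ x
  ≈0⇒∣ {x} (mod P∣x-0) = ≡.subst (P ∣ₛ_) (x-0≡x x) P∣x-0

  ≈-reflexive : ∀ {x y} → x ≡ y → x ≈ y
  ≈-reflexive {x} ≡.refl = mod (≡.subst (P ∣ₛ_) (≡.sym (x-x≡0 x)) (Signed.divides 0ℤ ≡.refl))

  ≈-refl : ∀ {x} → x ≈ x
  ≈-refl = ≈-reflexive ≡.refl

  ≈-sym : ∀ {x y} → x ≈ y → y ≈ x
  ≈-sym {x} {y} (mod d) = mod (≡.subst (P ∣ₛ_) (-[x-y]≡y-x x y) (Signed.∣m⇒∣-m d))

  ≈-trans : ∀ {x y z} → x ≈ y → y ≈ z → x ≈ z
  ≈-trans {x} {y} {z} (mod d) (mod e) = mod (≡.subst (P ∣ₛ_) ([x-y]+[y-z]≡x-z x y z) (Signed.∣m∣n⇒∣m+n d e))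

  +-cong : ∀ {x y u v} → x ≈ y → u ≈ v → x + u ≈ y + v
  +-cong {x} {y} {u} {v} (mod d) (mod e) =
    mod (≡.subst (P ∣ₛ_) ([x-y]+[u-v]≡[x+u]-[y+v] x y u v) (Signed.∣m∣n⇒∣m+n d e))

  *-cong : ∀ {x y u v} → x ≈ y → u ≈ v → x * u ≈ y * v
  *-cong {x} {y} {u} {v} (mod d) (mod e) =
    mod (≡.subst (P ∣ₛ_) (x[u-v]+[x-y]v≡xu-yv x y u v) (Signed.∣m∣n⇒∣m+n (Signed.∣n⇒∣m*n x e) (Signed.∣m⇒∣m*n v d)))

  -‿cong : ∀ {x y} → x ≈ y → - x ≈ - y
  -‿cong {x} {y} (mod d) = mod (≡.subst (P ∣ₛ_) (-[x-y]≡[-x]-[-y] x y) (Signed.∣m⇒∣-m d))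

  isCommutativeRing : IsCommutativeRing _≈_ _+_ _*_ -_ 0ℤ 1ℤ
  isCommutativeRing = record
    { isRing = record
      { +-isAbelianGroup = record
        { isGroup = record
          { isMonoid = record
            { isSemigroup = record
              { isMagma = record
                { isEquivalence = record { refl = ≈-refl ; sym = ≈-sym ; trans = ≈-trans }
                ; ∙-cong = +-cong }
              ; assoc = λ x y z → ≈-reflexive (ℤP.+-assoc x y z) }
            ; identity = ≈-reflexive ∘ ℤP.+-identityˡ , ≈-reflexive ∘ ℤP.+-identityʳ }
          ; inverse = ≈-reflexive ∘ ℤP.+-inverseˡ , ≈-reflexive ∘ ℤP.+-inverseʳ
          ; ⁻¹-cong = -‿cong }
        ; comm = λ x y → ≈-reflexive (ℤP.+-comm x y) }
      ; *-cong = *-cong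
      ; *-assoc = λ x y z → ≈-reflexive (ℤP.*-assoc x y z)
      ; *-identity = ≈-reflexive ∘ ℤP.*-identityˡ , ≈-reflexive ∘ ℤP.*-identityʳ
      ; distrib = (λ x y z → ≈-reflexive (ℤP.*-distribˡ-+ x y z)) , (λ x y z → ≈-reflexive (ℤP.*-distribʳ-+ x y z)) }
    ; *-comm = λ x y → ≈-reflexive (ℤP.*-comm x y) }

  commutativeRing : CommutativeRing 0ℓ 0ℓ
  commutativeRing = record { isCommutativeRing = isCommutativeRing }

  open CommutativeRing commutativeRing public using (setoid; commutativeSemiring)

  module ℤ/P = SumProductProperties commutativeSemiring

  *P≈0 : ∀ k → k * P ≈ 0ℤ
  *P≈0 k = ∣⇒≈0 (Signed.divides k ≡.refl)

  P≈0 : P ≈ 0ℤ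
  P≈0 = ∣⇒≈0 Signed.∣-refl

  x+1≈0⇒x≈-1 : ∀ {x} → x + 1ℤ ≈ 0ℤ → x ≈ -1ℤ
  x+1≈0⇒x≈-1 {x} x+1≈0 = ≈-trans (≈-reflexive (x≡[x+1]-1 x)) (+-cong x+1≈0 (≈-refl { -1ℤ}))
    where
    x≡[x+1]-1 : ∀ x → x ≡ x + 1ℤ + -1ℤ
    x≡[x+1]-1 = solve-∀

  open import Relation.Binary.Reasoning.Setoid setoid

  record InversePairing (n : ℕ) : Set where
    field
      partner        : ℕ → ℕ
      partner-range  : ∀ {i} → 2 ≤ i → i ≤ n → 2 ≤ partner i × partner i ≤ n
      involutive     : ∀ {i} → 2 ≤ i → i ≤ n → partner (partner i) ≡ i
      fixedPointFree : ∀ {i} → 2 ≤ i → i ≤ n → partner i ≢ i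
      inverse        : ∀ {i} → 2 ≤ i → i ≤ n → + i * + partner i ≈ 1ℤ

  module PartialProducts {n} (π : InversePairing n) where
    open InversePairing π

    weight : ∀ {A : Set} → Dec A → ℕ → ℤ
    weight (yes _) i = + i
    weight (no _)  i = 1ℤ

    weight-yes : ∀ {A : Set} (a? : Dec A) {i} → A → weight a? i ≡ + i
    weight-yes (yes _)  _ = ≡.refl
    weight-yes (no ¬a)  a = ⊥-elim (¬a a)

    weight-no : ∀ {A : Set} (a? : Dec A) {i} → ¬ A → weight a? i ≡ 1ℤ
    weight-no (yes a) ¬a = ⊥-elim (¬a a)
    weight-no (no _)  _  = ≡.refl

    counted? : ∀ N i → Dec (2 ≤ i × partner i < N)
    counted? N i = 2 ℕ.≤? i ×-dec partner i ℕ.<? N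

    joins? : ∀ N i → Dec (2 ≤ i × partner i ≡ N)
    joins? N i = 2 ℕ.≤? i ×-dec partner i ℕ.≟ N

    counted joining : ℕ → ℕ → ℤ
    counted N i = weight (counted? N i) i
    joining N i = weight (joins? N i) i

    -- partial N multiplies the i < N whose partner is below N too, so it only grows by
    -- whole pairs i · partner i ≡ 1; at N = n + 1 every i ≥ 2 is counted
    partial : ℕ → ℤ
    partial N = ∏[ i < N ] counted N i

    counted-suc : ∀ N i → counted (suc N) i ≡ counted N i * joining N i
    counted-suc N zero          = ≡.refl
    counted-suc N (suc zero)    = ≡.refl
    counted-suc N i@(suc (suc _)) with ℕP.<-cmp (partner i) N
    ... | tri< σi<N σi≢N _ =
      ≡.trans (weight-yes (counted? (suc N) i) (2≤i , ℕP.m<n⇒m<1+n σi<N))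
              (≡.sym (≡.trans (≡.cong₂ _*_ (weight-yes (counted? N i) (2≤i , σi<N)) (weight-no (joins? N i) (σi≢N ∘ proj₂)))
                              (ℤP.*-identityʳ (+ i))))
      where
      2≤i : 2 ≤ i
      2≤i = s≤s (s≤s z≤n)
    ... | tri≈ _ σi≡N _ =
      ≡.trans (weight-yes (counted? (suc N) i) (2≤i , ℕP.≤-reflexive (≡.cong suc σi≡N)))
              (≡.sym (≡.trans (≡.cong₂ _*_ (weight-no (counted? N i) (ℕP.<-irrefl σi≡N ∘ proj₂)) (weight-yes (joins? N i) (2≤i , σi≡N)))
                              (ℤP.*-identityˡ (+ i))))
      where
      2≤i : 2 ≤ i
      2≤i = s≤s (s≤s z≤n)
    ... | tri> _ σi≢N N<σi =
      ≡.trans (weight-no (counted? (suc N) i) (ℕP.<⇒≱ N<σi ∘ ℕP.≤-pred ∘ proj₂))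
              (≡.sym (≡.cong₂ _*_ (weight-no (counted? N i) (ℕP.<⇒≯ N<σi ∘ proj₂)) (weight-no (joins? N i) (σi≢N ∘ proj₂))))

    joining-partner : ∀ {N} → 2 ≤ N → N ≤ n → partner N < N → joining N (partner N) ≡ + partner N
    joining-partner 2≤N N≤n _ =
      weight-yes (joins? _ _) (proj₁ (partner-range 2≤N N≤n) , involutive 2≤N N≤n)

    joining-other : ∀ {N i} → 2 ≤ N → N ≤ n → i < N → i ≢ partner N → joining N i ≡ 1ℤ
    joining-other 2≤N N≤n i<N i≢σN =
      weight-no (joins? _ _) λ (2≤i , σi≡N) →
        i≢σN (≡.trans (≡.sym (involutive 2≤i (ℕP.≤-trans (ℕP.<⇒≤ i<N) N≤n))) (≡.cong partner σi≡N))

    partial-suc : ∀ {N} → 2 ≤ N → N ≤ n → partial (suc N) ≈ partial N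
    partial-suc {N} 2≤N N≤n = begin
      partial (suc N)                                              ≡⟨ ∏.snoc N (counted (suc N)) ⟩
      (∏[ i < N ] counted (suc N) i) * counted (suc N) N           ≡⟨ ≡.cong (_* counted (suc N) N) split ⟩
      partial N * (∏[ i < N ] joining N i) * counted (suc N) N     ≡⟨ ℤP.*-assoc (partial N) _ _ ⟩
      partial N * ((∏[ i < N ] joining N i) * counted (suc N) N)   ≈⟨ *-cong (≈-refl {partial N}) (new-pair (ℕP.<-cmp (partner N) N)) ⟩
      partial N * 1ℤ                                               ≡⟨ ℤP.*-identityʳ (partial N) ⟩
      partial N                                                    ∎
      where
      split : ∏[ i < N ] counted (suc N) i ≡ partial N * (∏[ i < N ] joining N i)
      split = ≡.trans (∏.cong-< N (λ i _ → counted-suc N i)) (∏.distrib N (counted N) (joining N))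
      new-pair : Tri (partner N < N) (partner N ≡ N) (N < partner N) → (∏[ i < N ] joining N i) * counted (suc N) N ≈ 1ℤ
      new-pair (tri< σN<N _ _) = begin
        (∏[ i < N ] joining N i) * counted (suc N) N  ≈⟨ *-cong (ℤ/P.∏.single N (partner N) σN<N (≈-reflexive (joining-partner 2≤N N≤n σN<N))
                                                                 (λ i i<N i≢σN → ≈-reflexive (joining-other 2≤N N≤n i<N i≢σN)))
                                                               (≈-reflexive (weight-yes (counted? (suc N) N) (2≤N , ℕP.m<n⇒m<1+n σN<N))) ⟩
        + partner N * + N                             ≡⟨ ℤP.*-comm (+ partner N) (+ N) ⟩
        + N * + partner N                             ≈⟨ inverse 2≤N N≤n ⟩
        1ℤ                                            ∎
      new-pair (tri≈ _ σN≡N _) = ⊥-elim (fixedPointFree 2≤N N≤n σN≡N)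
      new-pair (tri> _ _ N<σN) = begin
        (∏[ i < N ] joining N i) * counted (suc N) N  ≈⟨ *-cong (ℤ/P.∏.trivial N (λ i i<N → ≈-reflexive (joining-other 2≤N N≤n i<N
                                                                   (λ i≡σN → ℕP.<-asym i<N (≡.subst (N <_) (≡.sym i≡σN) N<σN)))))
                                                               (≈-reflexive (weight-no (counted? (suc N) N) (ℕP.<⇒≱ N<σN ∘ ℕP.≤-pred ∘ proj₂))) ⟩
        1ℤ * 1ℤ                                       ≡⟨⟩
        1ℤ                                            ∎

    partial≈1 : ∀ k → 2 ℕ.+ k ≤ suc n → partial (2 ℕ.+ k) ≈ 1ℤ
    partial≈1 zero    _    = ≈-refl
    partial≈1 (suc k) 3+k≤1+n =
      ≈-trans (partial-suc (s≤s (s≤s z≤n)) (ℕP.≤-pred 3+k≤1+n)) (partial≈1 k (ℕP.<⇒≤ 3+k≤1+n))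

    partial-top : partial (suc n) ≡ + (n !)
    partial-top = ≡.trans (ℤP.*-identityˡ _) (≡.trans (∏.cong-< n counted-below) (≡.sym (+[n!]≡∏ n)))
      where
      counted-below : ∀ i → i < n → counted (suc n) (suc i) ≡ + suc i
      counted-below zero    _   = ≡.refl
      counted-below (suc j) j<n = weight-yes (counted? (suc n) (2 ℕ.+ j)) (2≤ , s≤s (proj₂ (partner-range 2≤ j<n)))
        where
        2≤ : 2 ≤ 2 ℕ.+ j
        2≤ = s≤s (s≤s z≤n)

  inversePairing⇒n!≈1 : ∀ {n} → InversePairing n → + (n !) ≈ 1ℤ
  inversePairing⇒n!≈1 {zero}  _ = ≈-refl
  inversePairing⇒n!≈1 {suc k} π = ≈-trans (≈-reflexive (≡.sym (partial-top π))) (partial≈1 π k ℕP.≤-refl)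
    where open PartialProducts

-- The binomial theorem

sum≡∑< : ∀ k (f : ℕ → ℤ) → ∑ᶠ {k} (f ∘ toℕ) ≡ ∑< k f
sum≡∑< zero    f = ≡.refl
sum≡∑< (suc k) f = ≡.cong (_+_ (f 0)) (sum≡∑< k (f ∘ suc))

×ᴿ≡+* : ∀ m x → m ×ᴿ x ≡ + m * x
×ᴿ≡+* zero    x = ≡.sym (ℤP.*-zeroˡ x)
×ᴿ≡+* (suc m) x = ≡.trans (≡.cong (_+_ x) (×ᴿ≡+* m x)) (≡.sym (ℤP.suc-* (+ m) x))

^ᴿ≡^ : ∀ x n → x ^ᴿ n ≡ x ^ n
^ᴿ≡^ x zero    = ≡.refl
^ᴿ≡^ x (suc n) = ≡.cong (x *_) (^ᴿ≡^ x n)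

binomial-theorem : ∀ n x → (x + 1ℤ) ^ n ≡ ∑[ k < suc n ] + (n C k) * x ^ k
binomial-theorem n x = begin
  (x + 1ℤ) ^ n                                  ≡⟨ ^ᴿ≡^ (x + 1ℤ) n ⟨
  (x + 1ℤ) ^ᴿ n                                 ≡⟨ Binomial.theorem n x 1ℤ ⟩
  ∑ᶠ {suc n} (term ∘ toℕ)                      ≡⟨ sum≡∑< (suc n) term ⟩
  ∑[ k < suc n ] term k                         ≡⟨ ∑.cong-< (suc n) (λ k _ → term≡ k) ⟩
  ∑[ k < suc n ] + (n C k) * x ^ k              ∎
  where
  open ≡.≡-Reasoning
  term : ℕ → ℤ
  term k = (n C k) ×ᴿ (x ^ᴿ k * 1ℤ ^ᴿ (n ∸ k))
  term≡ : ∀ k → term k ≡ + (n C k) * x ^ k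
  term≡ k = begin
    (n C k) ×ᴿ (x ^ᴿ k * 1ℤ ^ᴿ (n ∸ k))   ≡⟨ ×ᴿ≡+* (n C k) _ ⟩
    + (n C k) * (x ^ᴿ k * 1ℤ ^ᴿ (n ∸ k))
      ≡⟨ ≡.cong₂ (λ u v → + (n C k) * (u * v)) (^ᴿ≡^ x k) (≡.trans (^ᴿ≡^ 1ℤ (n ∸ k)) (ℤP.^-zeroˡ (n ∸ k))) ⟩
    + (n C k) * (x ^ k * 1ℤ)              ≡⟨ ≡.cong (+ (n C k) *_) (ℤP.*-identityʳ (x ^ k)) ⟩
    + (n C k) * x ^ k                     ∎

[k+1]*[n+1]C[k+1]≡[n+1]*nCk : ∀ n k → suc k ℕ.* (suc n C suc k) ≡ suc n ℕ.* (n C k)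
[k+1]*[n+1]C[k+1]≡[n+1]*nCk zero    zero    = ≡.refl
[k+1]*[n+1]C[k+1]≡[n+1]*nCk zero    (suc k) = ℕP.*-zeroʳ (suc (suc k))
[k+1]*[n+1]C[k+1]≡[n+1]*nCk (suc n) zero    = ≡.trans (ℕP.+-identityʳ _) (≡.trans (nC1≡n (suc (suc n))) (≡.sym (ℕP.*-identityʳ (suc (suc n)))))
[k+1]*[n+1]C[k+1]≡[n+1]*nCk (suc n) (suc k) = begin
  suc (suc k) ℕ.* (suc (suc n) C suc (suc k))
    ≡⟨ ≡.cong (suc (suc k) ℕ.*_) (nCk+nC[k+1]≡[n+1]C[k+1] (suc n) (suc k)) ⟨
  suc (suc k) ℕ.* (X ℕ.+ suc n C suc (suc k))
    ≡⟨ ℕP.*-distribˡ-+ (suc (suc k)) X _ ⟩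
  X ℕ.+ suc k ℕ.* X ℕ.+ suc (suc k) ℕ.* (suc n C suc (suc k))
    ≡⟨ ≡.cong₂ (λ u v → X ℕ.+ u ℕ.+ v) ([k+1]*[n+1]C[k+1]≡[n+1]*nCk n k) ([k+1]*[n+1]C[k+1]≡[n+1]*nCk n (suc k)) ⟩
  X ℕ.+ suc n ℕ.* (n C k) ℕ.+ suc n ℕ.* (n C suc k)
    ≡⟨ ℕP.+-assoc X _ _ ⟩
  X ℕ.+ (suc n ℕ.* (n C k) ℕ.+ suc n ℕ.* (n C suc k))
    ≡⟨ ≡.cong (X ℕ.+_) (ℕP.*-distribˡ-+ (suc n) (n C k) (n C suc k)) ⟨
  X ℕ.+ suc n ℕ.* (n C k ℕ.+ n C suc k)
    ≡⟨ ≡.cong (λ z → X ℕ.+ suc n ℕ.* z) (nCk+nC[k+1]≡[n+1]C[k+1] n k) ⟩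
  suc (suc n) ℕ.* X ∎
  where
  open ≡.≡-Reasoning
  X : ℕ
  X = suc n C suc k


-- Rising and falling factorials

rise : ℤ → ℕ → ℤ
rise a d = ∏[ i < d ] (a + + suc i)

fall : ℤ → ℕ → ℤ
fall b e = ∏[ i < e ] (b - + i)

rise-suc : ∀ a d → rise a (suc d) ≡ (a + 1ℤ) * rise (a + 1ℤ) d
rise-suc a d = ≡.cong ((a + 1ℤ) *_) (∏.cong-< d (λ i _ → shift a (+ suc i)))
  where
  shift : ∀ a i → a + (1ℤ + i) ≡ a + 1ℤ + i
  shift = solve-∀

rise-pascal : ∀ a d → rise (a + 1ℤ) (suc d) ≡ rise a (suc d) + + suc d * rise (a + 1ℤ) d
rise-pascal a d = begin
  rise (a + 1ℤ) (suc d)                              ≡⟨ ∏.snoc d (λ i → a + 1ℤ + + suc i) ⟩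
  rise (a + 1ℤ) d * (a + 1ℤ + + suc d)               ≡⟨ split (rise (a + 1ℤ) d) (a + 1ℤ) (+ suc d) ⟩
  (a + 1ℤ) * rise (a + 1ℤ) d + + suc d * rise (a + 1ℤ) d ≡⟨ ≡.cong (_+ + suc d * rise (a + 1ℤ) d) (rise-suc a d) ⟨
  rise a (suc d) + + suc d * rise (a + 1ℤ) d         ∎
  where
  open ≡.≡-Reasoning
  split : ∀ r x s → r * (x + s) ≡ x * r + s * r
  split = solve-∀

fall-suc : ∀ b e → fall (b + 1ℤ) (suc e) ≡ (b + 1ℤ) * fall b e
fall-suc b e = ≡.cong₂ _*_ (ℤP.+-identityʳ (b + 1ℤ)) (∏.cong-< e (λ i _ → shift b (+ i)))
  where
  shift : ∀ b i → b + 1ℤ - (1ℤ + i) ≡ b - i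
  shift = solve-∀

fall-pascal : ∀ b e → fall (b + 1ℤ) (suc e) ≡ fall b (suc e) + + suc e * fall b e
fall-pascal b e = begin
  fall (b + 1ℤ) (suc e)                     ≡⟨ fall-suc b e ⟩
  (b + 1ℤ) * fall b e                       ≡⟨ split (fall b e) b (+ e) ⟩
  fall b e * (b - + e) + (1ℤ + + e) * fall b e ≡⟨ ≡.cong (_+ (1ℤ + + e) * fall b e) (∏.snoc e (λ i → b - + i)) ⟨
  fall b (suc e) + + suc e * fall b e       ∎
  where
  open ≡.≡-Reasoning
  split : ∀ f b e → (b + 1ℤ) * f ≡ f * (b - e) + (1ℤ + e) * f
  split = solve-∀

fall-vanish : ∀ {b} k → b ≤ k → fall (+ b) (suc k) ≡ 0ℤ
fall-vanish {b} k b≤k = ∏-zero (suc k) {λ i → + b - + i} b (s≤s b≤k) (ℤP.+-inverseʳ (+ b))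

rise-0ℤ : ∀ k → rise 0ℤ k ≡ + (k !)
rise-0ℤ k = ≡.trans (∏.cong-< k (λ i _ → ℤP.+-identityˡ (+ suc i))) (≡.sym (+[n!]≡∏ k))

fall-diagonal : ∀ k → fall (+ k) k ≡ + (k !)
fall-diagonal zero    = ≡.refl
fall-diagonal (suc k) = begin
  fall (+ suc k) (suc k)       ≡⟨ ≡.cong (λ b → fall b (suc k)) (pos-suc k) ⟩
  fall (+ k + 1ℤ) (suc k)      ≡⟨ fall-suc (+ k) k ⟩
  (+ k + 1ℤ) * fall (+ k) k    ≡⟨ ≡.cong₂ _*_ (≡.sym (pos-suc k)) (fall-diagonal k) ⟩
  + suc k * + (k !)            ≡⟨ ℤP.pos-* (suc k) (k !) ⟨
  + (suc k !)                  ∎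
  where open ≡.≡-Reasoning

riseFall : ℕ → ℤ → ℤ → ℤ
riseFall N a b = ∑⁺ N (λ d e → rise a d * fall b e)

∑⁺-weights : ∀ N Z → ∑⁺ N (λ d e → + suc d * Z d e) + ∑⁺ N (λ d e → + suc e * Z d e) ≡ + suc (suc N) * ∑⁺ N Z
∑⁺-weights N Z = begin
  ∑⁺ N (λ d e → + suc d * Z d e) + ∑⁺ N (λ d e → + suc e * Z d e)
    ≡⟨ ∑.distrib (suc N) (λ d → + suc d * Z d (N ∸ d)) (λ d → + suc (N ∸ d) * Z d (N ∸ d)) ⟨
  ∑⁺ N (λ d e → + suc d * Z d e + + suc e * Z d e)
    ≡⟨ ∑⁺-cong N weights ⟩
  ∑⁺ N (λ d e → + suc (suc N) * Z d e)
    ≡⟨ ∑-*ˡ (suc N) (+ suc (suc N)) (λ d → Z d (N ∸ d)) ⟩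
  + suc (suc N) * ∑⁺ N Z ∎
  where
  open ≡.≡-Reasoning
  weights : ∀ d e → d ℕ.+ e ≡ N → + suc d * Z d e + + suc e * Z d e ≡ + suc (suc N) * Z d e
  weights d e d+e≡N = begin
    + suc d * Z d e + + suc e * Z d e   ≡⟨ ℤP.*-distribʳ-+ (Z d e) (+ suc d) (+ suc e) ⟨
    (+ suc d + + suc e) * Z d e         ≡⟨ ≡.cong (_* Z d e) (ℤP.pos-+ (suc d) (suc e)) ⟨
    + (suc d ℕ.+ suc e) * Z d e         ≡⟨ ≡.cong (λ m → + suc m * Z d e) (≡.trans (ℕP.+-suc d e) (≡.cong suc d+e≡N)) ⟩
    + suc (suc N) * Z d e               ∎

riseFall-fallPascal : ∀ N a b →
  riseFall (suc N) a (b + 1ℤ) ≡ riseFall (suc N) a b + ∑⁺ N (λ d e → + suc e * (rise a d * fall b e))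
riseFall-fallPascal N a b = begin
  riseFall (suc N) a (b + 1ℤ)                   ≡⟨ ∑⁺-last N (λ d e → rise a d * fall (b + 1ℤ) e) ⟩
  ∑⁺ N (λ d e → rise a d * fall (b + 1ℤ) (suc e)) + T
    ≡⟨ ≡.cong (_+ T) (≡.trans (∑⁺-cong N (λ d e _ → pointwise d e)) (∑.distrib (suc N) (λ d → X d (N ∸ d)) (λ d → Y d (N ∸ d)))) ⟩
  ∑⁺ N X + ∑⁺ N Y + T                           ≡⟨ swap (∑⁺ N X) (∑⁺ N Y) T ⟩
  ∑⁺ N X + T + ∑⁺ N Y                           ≡⟨ ≡.cong (_+ ∑⁺ N Y) (∑⁺-last N (λ d e → rise a d * fall b e)) ⟨
  riseFall (suc N) a b + ∑⁺ N Y                 ∎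
  where
  open ≡.≡-Reasoning
  T : ℤ
  T = rise a (suc N) * 1ℤ
  X Y : ℕ → ℕ → ℤ
  X d e = rise a d * fall b (suc e)
  Y d e = + suc e * (rise a d * fall b e)
  distrib : ∀ r f g s → r * (f + s * g) ≡ r * f + s * (r * g)
  distrib = solve-∀
  pointwise : ∀ d e → rise a d * fall (b + 1ℤ) (suc e) ≡ X d e + Y d e
  pointwise d e = ≡.trans (≡.cong (rise a d *_) (fall-pascal b e)) (distrib (rise a d) (fall b (suc e)) (fall b e) (+ suc e))
  swap : ∀ x y t → x + y + t ≡ x + t + y
  swap = solve-∀

riseFall-risePascal : ∀ N a b →
  riseFall (suc N) (a + 1ℤ) b ≡ riseFall (suc N) a b + ∑⁺ N (λ d e → + suc d * (rise (a + 1ℤ) d * fall b e))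
riseFall-risePascal N a b = begin
  T + ∑⁺ N (λ d e → rise (a + 1ℤ) (suc d) * fall b e)
    ≡⟨ ≡.cong (_+_ T) (≡.trans (∑⁺-cong N (λ d e _ → pointwise d e)) (∑.distrib (suc N) (λ d → X d (N ∸ d)) (λ d → Y d (N ∸ d)))) ⟩
  T + (∑⁺ N X + ∑⁺ N Y)                          ≡⟨ ℤP.+-assoc T (∑⁺ N X) (∑⁺ N Y) ⟨
  riseFall (suc N) a b + ∑⁺ N Y                  ∎
  where
  open ≡.≡-Reasoning
  T : ℤ
  T = 1ℤ * fall b (suc N)
  X Y : ℕ → ℕ → ℤ
  X d e = rise a (suc d) * fall b e
  Y d e = + suc d * (rise (a + 1ℤ) d * fall b e)
  distrib : ∀ r s q f → (r + s * q) * f ≡ r * f + s * (q * f)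
  distrib = solve-∀
  pointwise : ∀ d e → rise (a + 1ℤ) (suc d) * fall b e ≡ X d e + Y d e
  pointwise d e = ≡.trans (≡.cong (_* fall b e) (rise-pascal a d)) (distrib (rise a (suc d)) (+ suc d) (rise (a + 1ℤ) d) (fall b e))

riseFall-shift : ∀ N a b →
  riseFall (suc N) (a + 1ℤ) (b + 1ℤ) ≡ riseFall (suc N) a b + + suc (suc N) * riseFall N (a + 1ℤ) b
riseFall-shift N a b = begin
  riseFall (suc N) (a + 1ℤ) (b + 1ℤ)                     ≡⟨ riseFall-fallPascal N (a + 1ℤ) b ⟩
  riseFall (suc N) (a + 1ℤ) b + ∑⁺ N (λ d e → + suc e * Z d e) ≡⟨ ≡.cong (_+ ∑⁺ N (λ d e → + suc e * Z d e)) (riseFall-risePascal N a b) ⟩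
  riseFall (suc N) a b + ∑⁺ N (λ d e → + suc d * Z d e) + ∑⁺ N (λ d e → + suc e * Z d e)
    ≡⟨ ℤP.+-assoc (riseFall (suc N) a b) _ _ ⟩
  riseFall (suc N) a b + (∑⁺ N (λ d e → + suc d * Z d e) + ∑⁺ N (λ d e → + suc e * Z d e))
    ≡⟨ ≡.cong (_+_ (riseFall (suc N) a b)) (∑⁺-weights N Z) ⟩
  riseFall (suc N) a b + + suc (suc N) * riseFall N (a + 1ℤ) b ∎
  where
  open ≡.≡-Reasoning
  Z : ℕ → ℕ → ℤ
  Z d e = rise (a + 1ℤ) d * fall b e

weightedRiseFall : (ℕ → ℤ) → ℕ → ℤ → ℤ → ℤ
weightedRiseFall c N a b = ∑⁺ N (λ d e → c (suc d) * rise a (suc d) * fall b (suc e))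

weightedRiseFall-fallPascal : ∀ c N a b →
  weightedRiseFall c N a (b + 1ℤ) ≡ weightedRiseFall c N a b + ∑⁺ N (λ d e → c (suc d) * + suc e * (rise a (suc d) * fall b e))
weightedRiseFall-fallPascal c N a b =
  ≡.trans (∑⁺-cong N (λ d e _ → pointwise d e)) (∑.distrib (suc N) (λ d → X d (N ∸ d)) (λ d → Y d (N ∸ d)))
  where
  X Y : ℕ → ℕ → ℤ
  X d e = c (suc d) * rise a (suc d) * fall b (suc e)
  Y d e = c (suc d) * + suc e * (rise a (suc d) * fall b e)
  distrib : ∀ c r f s g → c * r * (f + s * g) ≡ c * r * f + c * s * (r * g)
  distrib = solve-∀
  pointwise : ∀ d e → c (suc d) * rise a (suc d) * fall (b + 1ℤ) (suc e) ≡ X d e + Y d e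
  pointwise d e = ≡.trans (≡.cong (c (suc d) * rise a (suc d) *_) (fall-pascal b e))
                          (distrib (c (suc d)) (rise a (suc d)) (fall b (suc e)) (+ suc e) (fall b e))

riseFall-atZero : ∀ N a → riseFall (suc N) a 0ℤ ≡ rise a (suc N)
-- fall 0ℤ (suc e) reduces to 0ℤ
riseFall-atZero N a = begin
  riseFall (suc N) a 0ℤ                                    ≡⟨ ∑⁺-last N (λ d e → rise a d * fall 0ℤ e) ⟩
  ∑⁺ N (λ d e → rise a d * fall 0ℤ (suc e)) + rise a (suc N) * 1ℤ
    ≡⟨ ≡.cong₂ _+_ (∑.trivial (suc N) (λ d _ → ℤP.*-zeroʳ (rise a d))) (ℤP.*-identityʳ (rise a (suc N))) ⟩
  0ℤ + rise a (suc N)                                      ≡⟨ ℤP.+-identityˡ (rise a (suc N)) ⟩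
  rise a (suc N)                                           ∎
  where open ≡.≡-Reasoning

weightedRiseFall-atZero : ∀ c N a → weightedRiseFall c N a 0ℤ ≡ 0ℤ
weightedRiseFall-atZero c N a = ∑.trivial (suc N) (λ d _ → ℤP.*-zeroʳ (c (suc d) * rise a (suc d)))

-- Arithmetic modulo a prime

module PrimeModulus (n : ℕ) (p-prime : Prime (2 ℕ.+ n)) where

  p : ℕ
  p = 2 ℕ.+ n

  open Modulo (+ p) public
  open import Relation.Binary.Reasoning.Setoid setoid

  p∤ : ∀ {k} → 0 < k → k < p → ¬ (+ p ∣ₛ + k)
  p∤ {suc k} _ k<p p∣k = ℕP.<⇒≱ k<p (ℕ.∣⇒≤ (Signed.∣⇒∣ᵤ p∣k))

  euclid : ∀ x y → + p ∣ₛ x * y → + p ∣ₛ x ⊎ + p ∣ₛ y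
  euclid x y p∣xy with euclidsLemma ℤ.∣ x ∣ ℤ.∣ y ∣ p-prime (≡.subst (p ℕ.∣_) (ℤP.abs-* x y) (Signed.∣⇒∣ᵤ p∣xy))
  ... | inj₁ p∣x = inj₁ (Signed.∣ᵤ⇒∣ p∣x)
  ... | inj₂ p∣y = inj₂ (Signed.∣ᵤ⇒∣ p∣y)

  *-cancelˡ : ∀ {u} x y → 0 < u → u < p → + u * x ≈ + u * y → x ≈ y
  *-cancelˡ {u} x y 0<u u<p (mod p∣ux-uy) =
    [ (λ p∣u → ⊥-elim (p∤ 0<u u<p p∣u)) , mod ]′ (euclid (+ u) (x - y) (≡.subst (+ p ∣ₛ_) (ux-uy≡u[x-y] (+ u) x y) p∣ux-uy))
    where
    ux-uy≡u[x-y] : ∀ u x y → u * x - u * y ≡ u * (x - y)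
    ux-uy≡u[x-y] = solve-∀

  ≈0⇒≡0 : ∀ {k} → k < p → + k ≈ 0ℤ → k ≡ 0
  ≈0⇒≡0 {zero}  _   _   = ≡.refl
  ≈0⇒≡0 {suc k} k<p k≈0 = ⊥-elim (p∤ (s≤s z≤n) k<p (≈0⇒∣ k≈0))

  private
    ≤∧≈⇒≡ : ∀ {u v} → u ≤ v → v < p → + v ≈ + u → u ≡ v
    ≤∧≈⇒≡ {u} u≤v v<p v≈u with ℕP.m≤n⇒∃[o]m+o≡n u≤v
    ... | k , ≡.refl = ≡.sym (≡.trans (≡.cong (u ℕ.+_) k≡0) (ℕP.+-identityʳ u))
      where
      [u+k]-u≡k : ∀ u k → (u + k) - u ≡ k
      [u+k]-u≡k = solve-∀
      k≡0 : k ≡ 0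
      k≡0 = ≈0⇒≡0 (ℕP.≤-<-trans (ℕP.m≤n+m k u) v<p) (begin
        + k                     ≡⟨ ≡.trans (≡.cong (_- + u) (ℤP.pos-+ u k)) ([u+k]-u≡k (+ u) (+ k)) ⟨
        + (u ℕ.+ k) - + u       ≈⟨ ∣⇒≈0 (divides v≈u) ⟩
        0ℤ                      ∎)

  ≈⇒≡ : ∀ {u v} → u < p → v < p → + u ≈ + v → u ≡ v
  ≈⇒≡ {u} {v} u<p v<p u≈v with ℕP.≤-total u v
  ... | inj₁ u≤v = ≤∧≈⇒≡ u≤v v<p (≈-sym u≈v)
  ... | inj₂ v≤u = ≡.sym (≤∧≈⇒≡ v≤u u<p u≈v)

  ∣⇒+≈0 : ∀ {k} → p ℕ.∣ k → + k ≈ 0ℤ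
  ∣⇒+≈0 {k} p∣k = ∣⇒≈0 (Signed.∣ᵤ⇒∣ {+ p} {+ k} p∣k)

  p∣pCk : ∀ {k} → 0 < k → k < p → p ℕ.∣ p C k
  p∣pCk {suc k} _ k<p with euclidsLemma (suc k) (p C suc k) p-prime
                              (≡.subst (p ℕ.∣_) (≡.sym ([k+1]*[n+1]C[k+1]≡[n+1]*nCk (suc n) k)) (ℕ.m∣m*n (suc n C k)))
  ... | inj₁ p∣k+1 = ⊥-elim (ℕP.<⇒≱ k<p (ℕ.∣⇒≤ p∣k+1))
  ... | inj₂ p∣C   = p∣C

  [x+1]^p≈x^p+1 : ∀ x → (x + 1ℤ) ^ p ≈ x ^ p + 1ℤ
  [x+1]^p≈x^p+1 x = begin
    (x + 1ℤ) ^ p                                    ≡⟨ binomial-theorem p x ⟩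
    g 0 + (∑[ k < p ] g (suc k))                    ≈⟨ +-cong (≈-reflexive (ℤP.*-identityˡ 1ℤ)) (ℤ/P.∑.snoc (suc n) (g ∘ suc)) ⟩
    1ℤ + ((∑[ k < suc n ] g (suc k)) + g p)         ≈⟨ +-cong (≈-refl {1ℤ}) (+-cong middle (≈-reflexive last)) ⟩
    1ℤ + (0ℤ + x ^ p)                               ≡⟨ 1+[0+z]≡z+1 (x ^ p) ⟩
    x ^ p + 1ℤ                                      ∎
    where
    g : ℕ → ℤ
    g k = + (p C k) * x ^ k
    middle : ∑[ k < suc n ] g (suc k) ≈ 0ℤ
    middle = ℤ/P.∑.trivial (suc n) {g ∘ suc} (λ k k<1+n → begin
      + (p C suc k) * x ^ suc k  ≈⟨ *-cong (∣⇒+≈0 (p∣pCk (s≤s z≤n) (s≤s k<1+n))) (≈-refl {x ^ suc k}) ⟩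
      0ℤ * x ^ suc k            ≡⟨ ℤP.*-zeroˡ (x ^ suc k) ⟩
      0ℤ                        ∎)
    last : g p ≡ x ^ p
    last = ≡.trans (≡.cong (λ c → + c * x ^ p) (nCn≡1 p)) (ℤP.*-identityˡ (x ^ p))
    1+[0+z]≡z+1 : ∀ z → 1ℤ + (0ℤ + z) ≡ z + 1ℤ
    1+[0+z]≡z+1 = solve-∀

  x^p≈x : ∀ x → (+ x) ^ p ≈ + x
  x^p≈x zero    = ≈-refl
  x^p≈x (suc x) = begin
    (+ suc x) ^ p     ≡⟨ ≡.cong (_^ p) (pos-suc x) ⟩
    (+ x + 1ℤ) ^ p    ≈⟨ [x+1]^p≈x^p+1 (+ x) ⟩
    (+ x) ^ p + 1ℤ    ≈⟨ +-cong (x^p≈x x) (≈-refl {1ℤ}) ⟩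
    + x + 1ℤ          ≡⟨ pos-suc x ⟨
    + suc x           ∎

  fermat : ∀ {x} → 0 < x → x < p → (+ x) ^ (p ∸ 1) ≈ 1ℤ
  fermat {x} 0<x x<p = *-cancelˡ ((+ x) ^ (p ∸ 1)) 1ℤ 0<x x<p (begin
    (+ x) ^ p    ≈⟨ x^p≈x x ⟩
    + x          ≡⟨ ℤP.*-identityʳ (+ x) ⟨
    + x * 1ℤ     ∎)

  p-1≈-1 : + (p ∸ 1) ≈ -1ℤ
  p-1≈-1 = x+1≈0⇒x≈-1 (≈-trans (≈-reflexive (≡.sym (pos-suc (suc n)))) P≈0)

  module Wilson (inv : ℕ → ℤ) (inv-correct : ∀ {d} → 2 ≤ d → d ≤ n → + d * inv d ≈ 1ℤ) where

    σ : ℕ → ℕ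
    σ d = inv d ℤ.%ℕ p

    inv≈σ : ∀ d → inv d ≈ + σ d
    inv≈σ d = mod (Signed.divides (inv d ℤ./ℕ p)
      (≡.trans (≡.cong (_- + σ d) (ℤ.a≡a%ℕn+[a/ℕn]*n (inv d) p)) ([r+q]-r≡q (+ σ d) _)))
      where
      [r+q]-r≡q : ∀ r q → r + q - r ≡ q
      [r+q]-r≡q = solve-∀

    σ-inverse : ∀ {d} → 2 ≤ d → d ≤ n → + d * + σ d ≈ 1ℤ
    σ-inverse {d} 2≤d d≤n = ≈-trans (*-cong (≈-refl {+ d}) (≈-sym (inv≈σ d))) (inv-correct 2≤d d≤n)

    inverse-range : ∀ {d s} → 2 ≤ d → d ≤ n → s < p → + d * + s ≈ 1ℤ → 2 ≤ s × s ≤ n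
    inverse-range {d} {zero} _ _ _ d*0≈1 =
      ⊥-elim (p∤ (s≤s z≤n) (s≤s (s≤s z≤n)) (≈0⇒∣ (≈-trans (≈-sym d*0≈1) (≈-reflexive (ℤP.*-zeroʳ (+ d))))))
    inverse-range {d} {suc zero} 2≤d d≤n _ d*1≈1 =
      ⊥-elim (ℕP.<⇒≢ 2≤d (≡.sym (≈⇒≡ (ℕP.m≤n⇒m≤1+n (s≤s d≤n)) (s≤s (s≤s z≤n)) d≈1)))
      where
      d≈1 : + d ≈ 1ℤ
      d≈1 = ≈-trans (≈-reflexive (≡.sym (ℤP.*-identityʳ (+ d)))) d*1≈1
    inverse-range {d} {suc (suc t)} 2≤d d≤n s<p d*s≈1 with suc (suc t) ℕ.≟ suc n
    ... | no s≢1+n = s≤s (s≤s z≤n) , ℕP.≤-pred (ℕP.≤∧≢⇒< (ℕP.≤-pred s<p) s≢1+n)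
    ... | yes ≡.refl = ⊥-elim (p∤ (s≤s z≤n) (s≤s (s≤s d≤n)) (≈0⇒∣ (begin
      + suc d                    ≡⟨ ℤP.pos-+ 1 d ⟩
      1ℤ + + d                   ≈⟨ +-cong (≈-sym d*s≈1) (≈-refl {+ d}) ⟩
      + d * + suc n + + d        ≡⟨ ds+d≡d[s+1] (+ d) (+ suc n) ⟩
      + d * (+ suc n + 1ℤ)       ≡⟨ ≡.cong (+ d *_) (pos-suc (suc n)) ⟨
      + d * + p                  ≈⟨ *P≈0 (+ d) ⟩
      0ℤ                         ∎)))
      where
      ds+d≡d[s+1] : ∀ d s → d * s + d ≡ d * (s + 1ℤ)
      ds+d≡d[s+1] = solve-∀

    σ<p : ∀ d → σ d < p
    σ<p d = ℤ.n%ℕd<d (inv d) p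

    σ-range : ∀ {d} → 2 ≤ d → d ≤ n → 2 ≤ σ d × σ d ≤ n
    σ-range 2≤d d≤n = inverse-range 2≤d d≤n (σ<p _) (σ-inverse 2≤d d≤n)

    σ-involutive : ∀ {d} → 2 ≤ d → d ≤ n → σ (σ d) ≡ d
    σ-involutive {d} 2≤d d≤n = ≈⇒≡ (σ<p (σ d)) (s≤s (ℕP.m≤n⇒m≤1+n d≤n)) (begin
      + σ (σ d)                  ≡⟨ ℤP.*-identityˡ _ ⟨
      1ℤ * + σ (σ d)             ≈⟨ *-cong (≈-sym (σ-inverse 2≤d d≤n)) ≈-refl ⟩
      + d * + σ d * + σ (σ d)    ≡⟨ ℤP.*-assoc (+ d) _ _ ⟩
      + d * (+ σ d * + σ (σ d))  ≈⟨ *-cong (≈-refl {+ d}) (σ-inverse (proj₁ σd-range) (proj₂ σd-range)) ⟩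
      + d * 1ℤ                   ≡⟨ ℤP.*-identityʳ (+ d) ⟩
      + d                        ∎)
      where
      σd-range : 2 ≤ σ d × σ d ≤ n
      σd-range = σ-range 2≤d d≤n

    σ-fixedPointFree : ∀ {d} → 2 ≤ d → d ≤ n → σ d ≢ d
    σ-fixedPointFree {d@(suc d-1)} 2≤d d≤n σd≡d =
      [ p∤ (ℕP.≤-pred 2≤d) (ℕP.<-trans (ℕP.n<1+n d-1) d<p)
      , p∤ (s≤s z≤n) (s≤s (s≤s d≤n)) ∘ ≡.subst (+ p ∣ₛ_) (≡.sym (pos-suc d)) ]′
      (euclid (+ d-1) (+ d + 1ℤ) (≈0⇒∣ (begin
        + d-1 * (+ d + 1ℤ)         ≡⟨⟩
        (+ d - 1ℤ) * (+ d + 1ℤ)    ≡⟨ [x-1][x+1]≡x*x-1 (+ d) ⟩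
        + d * + d - 1ℤ             ≈⟨ +-cong d²≈1 (≈-refl { -1ℤ}) ⟩
        1ℤ - 1ℤ                    ≡⟨ ℤP.+-inverseʳ 1ℤ ⟩
        0ℤ                         ∎)))
      where
      d<p : d < p
      d<p = s≤s (ℕP.m≤n⇒m≤1+n d≤n)
      [x-1][x+1]≡x*x-1 : ∀ x → (x - 1ℤ) * (x + 1ℤ) ≡ x * x - 1ℤ
      [x-1][x+1]≡x*x-1 = solve-∀
      d²≈1 : + d * + d ≈ 1ℤ
      d²≈1 = ≡.subst (λ s → + d * + s ≈ 1ℤ) σd≡d (σ-inverse 2≤d d≤n)

    pairing : InversePairing n
    pairing = record
      { partner        = σ
      ; partner-range  = σ-range
      ; involutive     = σ-involutive
      ; fixedPointFree = σ-fixedPointFree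
      ; inverse        = σ-inverse
      }

    wilson : + ((p ∸ 1) !) ≈ -1ℤ
    wilson = begin
      + (suc n ℕ.* n !)   ≡⟨ ℤP.pos-* (suc n) (n !) ⟩
      + suc n * + (n !)   ≈⟨ *-cong p-1≈-1 (inversePairing⇒n!≈1 pairing) ⟩
      -1ℤ * 1ℤ            ≡⟨⟩
      -1ℤ                 ∎

  rise-vanish : ∀ {x} → 0 < x → x < p → rise (+ x) (p ∸ 1) ≈ 0ℤ
  rise-vanish {suc x} _ x<p = ℤ/P.∏-zero (suc n) {λ i → + suc x + + suc i} (n ∸ x) (s≤s (ℕP.m∸n≤m n x)) (begin
    + suc x + + suc (n ∸ x)       ≡⟨ ℤP.pos-+ (suc x) (suc (n ∸ x)) ⟨
    + (suc x ℕ.+ suc (n ∸ x))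
      ≡⟨ ≡.cong (+_ ∘ suc) (≡.trans (ℕP.+-suc x (n ∸ x)) (≡.cong suc (ℕP.m+[n∸m]≡n (ℕP.≤-pred (ℕP.≤-pred x<p))))) ⟩
    + p                           ≈⟨ P≈0 ⟩
    0ℤ                            ∎)

  riseFall-shift≈ : ∀ a b → riseFall (suc n) (a + 1ℤ) (b + 1ℤ) ≈ riseFall (suc n) a b
  riseFall-shift≈ a b = begin
    riseFall (suc n) (a + 1ℤ) (b + 1ℤ)                         ≡⟨ riseFall-shift n a b ⟩
    riseFall (suc n) a b + + p * riseFall n (a + 1ℤ) b         ≈⟨ +-cong (≈-refl {riseFall (suc n) a b}) (*-cong P≈0 (≈-refl {riseFall n (a + 1ℤ) b})) ⟩
    riseFall (suc n) a b + 0ℤ * riseFall n (a + 1ℤ) b          ≡⟨ ℤP.+-identityʳ (riseFall (suc n) a b) ⟩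
    riseFall (suc n) a b                                       ∎

  riseFall-shiftBy : ∀ k a b → riseFall (suc n) (a + + k) (b + + k) ≈ riseFall (suc n) a b
  riseFall-shiftBy zero    a b = ≈-reflexive (≡.cong₂ (riseFall (suc n)) (ℤP.+-identityʳ a) (ℤP.+-identityʳ b))
  riseFall-shiftBy (suc k) a b = begin
    riseFall (suc n) (a + + suc k) (b + + suc k)               ≡⟨ ≡.cong₂ (riseFall (suc n)) (shift a) (shift b) ⟩
    riseFall (suc n) (a + + k + 1ℤ) (b + + k + 1ℤ)             ≈⟨ riseFall-shift≈ (a + + k) (b + + k) ⟩
    riseFall (suc n) (a + + k) (b + + k)                       ≈⟨ riseFall-shiftBy k a b ⟩
    riseFall (suc n) a b                                       ∎
    where
    shift : ∀ x → x + + suc k ≡ x + + k + 1ℤ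
    shift x = ≡.trans (≡.cong (_+_ x) (pos-suc k)) (≡.sym (ℤP.+-assoc x (+ k) 1ℤ))

  fall-cong : ∀ e {b b′} → b ≈ b′ → fall b e ≈ fall b′ e
  fall-cong e {b} b≈b′ = ℤ/P.∏.cong-< e {λ i → b - + i} (λ i _ → +-cong b≈b′ (≈-refl { - (+ i)}))

  riseFall-congʳ : ∀ N a {b b′} → b ≈ b′ → riseFall N a b ≈ riseFall N a b′
  riseFall-congʳ N a {b} b≈b′ =
    ℤ/P.∑.cong-< (suc N) {λ d → rise a d * fall b (N ∸ d)} (λ d _ → *-cong (≈-refl {rise a d}) (fall-cong (N ∸ d) b≈b′))

  riseFall-diagonal : ∀ a → riseFall (suc n) (+ a) (+ a) ≈ + ((p ∸ 1) !)
  riseFall-diagonal a = begin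
    riseFall (suc n) (+ a) (+ a)                  ≡⟨ ≡.cong₂ (riseFall (suc n)) (ℤP.+-identityˡ (+ a)) (ℤP.+-identityˡ (+ a)) ⟨
    riseFall (suc n) (0ℤ + + a) (0ℤ + + a)        ≈⟨ riseFall-shiftBy a 0ℤ 0ℤ ⟩
    riseFall (suc n) 0ℤ 0ℤ                        ≡⟨ riseFall-atZero n 0ℤ ⟩
    rise 0ℤ (suc n)                               ≡⟨ rise-0ℤ (suc n) ⟩
    + ((p ∸ 1) !)                                 ∎

  riseFall-offDiagonal : ∀ {a b} → a < p → b < p → a ≢ b → riseFall (suc n) (+ a) (+ b) ≈ 0ℤ
  riseFall-offDiagonal {a} {b} a<p b<p a≢b with ℕP.<-cmp a b
  ... | tri≈ _ a≡b _ = ⊥-elim (a≢b a≡b)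
  ... | tri> _ _ b<a with ℕP.m≤n⇒∃[o]m+o≡n b<a
  ...   | o , ≡.refl = begin
    riseFall (suc n) (+ (suc b ℕ.+ o)) (+ b)      ≡⟨ ≡.cong₂ (riseFall (suc n)) a≡o+b (ℤP.+-identityˡ (+ b)) ⟩
    riseFall (suc n) (+ suc o + + b) (0ℤ + + b)   ≈⟨ riseFall-shiftBy b (+ suc o) 0ℤ ⟩
    riseFall (suc n) (+ suc o) 0ℤ                 ≡⟨ riseFall-atZero n (+ suc o) ⟩
    rise (+ suc o) (suc n)                        ≈⟨ rise-vanish (s≤s z≤n) (ℕP.≤-<-trans (s≤s (ℕP.m≤n+m o b)) a<p) ⟩
    0ℤ                                            ∎
    where
    a≡o+b : + (suc b ℕ.+ o) ≡ + suc o + + b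
    a≡o+b = ≡.trans (≡.cong (+_ ∘ suc) (ℕP.+-comm b o)) (ℤP.pos-+ (suc o) b)
  riseFall-offDiagonal {a} {b} a<p b<p a≢b | tri< a<b _ _ with ℕP.m≤n⇒∃[o]m+o≡n b<p
  ... | o , b+1+o≡p = begin
    riseFall (suc n) (+ a) (+ b)                      ≈⟨ riseFall-shiftBy (suc o) (+ a) (+ b) ⟨
    riseFall (suc n) (+ a + + suc o) (+ b + + suc o)  ≈⟨ riseFall-congʳ (suc n) (+ a + + suc o) b+k≈0 ⟩
    riseFall (suc n) (+ a + + suc o) 0ℤ               ≡⟨ riseFall-atZero n (+ a + + suc o) ⟩
    rise (+ a + + suc o) (suc n)                      ≡⟨ ≡.cong (λ x → rise x (suc n)) (ℤP.pos-+ a (suc o)) ⟨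
    rise (+ (a ℕ.+ suc o)) (suc n)                    ≈⟨ rise-vanish (ℕP.<-≤-trans (s≤s z≤n) (ℕP.m≤n+m (suc o) a)) a+k<p ⟩
    0ℤ                                                ∎
    where
    b+k≡p : b ℕ.+ suc o ≡ p
    b+k≡p = ≡.trans (ℕP.+-suc b o) b+1+o≡p
    b+k≈0 : + b + + suc o ≈ 0ℤ
    b+k≈0 = ≈-trans (≈-reflexive (≡.trans (≡.sym (ℤP.pos-+ b (suc o))) (≡.cong +_ b+k≡p))) P≈0
    a+k<p : a ℕ.+ suc o < p
    a+k<p = ≡.subst (a ℕ.+ suc o <_) b+k≡p (ℕP.+-monoˡ-< (suc o) a<b)

  module WithInverses (c : ℕ → ℤ) (c-inverse : ∀ {d} → d ≤ n → + suc d * c (suc d) ≈ 1ℤ) where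

    S : ℤ → ℤ → ℤ
    S = weightedRiseFall c n

    -- (d + 1) + (e + 1) = p, so c (d + 1) · (e + 1) ≡ − c (d + 1) · (d + 1)
    c*complement≈-1 : ∀ d e → d ℕ.+ e ≡ n → c (suc d) * + suc e ≈ -1ℤ
    c*complement≈-1 d e d+e≡n = x+1≈0⇒x≈-1 (begin
      c (suc d) * + suc e + 1ℤ                   ≈⟨ +-cong (≈-refl {c (suc d) * + suc e}) (≈-sym (c-inverse d≤n)) ⟩
      c (suc d) * + suc e + + suc d * c (suc d)  ≡⟨ regroup (c (suc d)) (+ suc e) (+ suc d) ⟩
      c (suc d) * (+ suc d + + suc e)            ≡⟨ ≡.cong (c (suc d) *_) (ℤP.pos-+ (suc d) (suc e)) ⟨
      c (suc d) * + (suc d ℕ.+ suc e)            ≡⟨ ≡.cong (λ m → c (suc d) * + suc m) (≡.trans (ℕP.+-suc d e) (≡.cong suc d+e≡n)) ⟩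
      c (suc d) * + p                            ≈⟨ *P≈0 (c (suc d)) ⟩
      0ℤ                                         ∎)
      where
      d≤n : d ≤ n
      d≤n = ≡.subst (d ≤_) d+e≡n (ℕP.m≤m+n d e)
      regroup : ∀ x s t → x * s + t * x ≡ x * (t + s)
      regroup = solve-∀

    S-step : ∀ a {b} → b ≤ n → S (+ a) (+ suc b) ≈ S (+ a) (+ b) - riseFall (suc n) (+ a) (+ b)
    S-step a {b} b≤n = begin
      S (+ a) (+ suc b)                                           ≡⟨ ≡.cong (S (+ a)) (pos-suc b) ⟩
      S (+ a) (+ b + 1ℤ)                                          ≡⟨ weightedRiseFall-fallPascal c n (+ a) (+ b) ⟩
      S (+ a) (+ b) + ∑⁺ n (λ d e → c (suc d) * + suc e * Z d e)
        ≈⟨ +-cong (≈-refl {S (+ a) (+ b)}) (ℤ/P.∑⁺-cong n (λ d e d+e≡n → *-cong (c*complement≈-1 d e d+e≡n) (≈-refl {Z d e}))) ⟩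
      S (+ a) (+ b) + ∑⁺ n (λ d e → -1ℤ * Z d e)                  ≡⟨ ≡.cong (_+_ (S (+ a) (+ b))) (∑-*ˡ (suc n) -1ℤ (λ d → Z d (n ∸ d))) ⟩
      S (+ a) (+ b) + -1ℤ * ∑⁺ n Z                                ≡⟨ ≡.cong (_+_ (S (+ a) (+ b))) (ℤP.-1*i≡-i (∑⁺ n Z)) ⟩
      S (+ a) (+ b) - ∑⁺ n Z                                      ≡⟨ ≡.cong (_-_ (S (+ a) (+ b))) riseFall≡ ⟨
      S (+ a) (+ b) - riseFall (suc n) (+ a) (+ b)                ∎
      where
      Z : ℕ → ℕ → ℤ
      Z d e = rise (+ a) (suc d) * fall (+ b) e
      riseFall≡ : riseFall (suc n) (+ a) (+ b) ≡ ∑⁺ n Z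
      riseFall≡ = ≡.trans (≡.cong (λ f → 1ℤ * f + ∑⁺ n Z) (fall-vanish n b≤n)) (ℤP.+-identityˡ (∑⁺ n Z))

    c-inverse-≥2 : ∀ {d} → 2 ≤ d → d ≤ n → + d * c d ≈ 1ℤ
    c-inverse-≥2 {suc d} _ d<n = c-inverse (ℕP.<⇒≤ d<n)

    open Wilson c c-inverse-≥2 using (wilson)

    S-values : ∀ {a} b → a < p → b < p → (a < b → S (+ a) (+ b) ≈ 1ℤ) × (b ≤ a → S (+ a) (+ b) ≈ 0ℤ)
    S-values {a} zero    _   _     = (λ ()) , λ _ → ≈-reflexive (weightedRiseFall-atZero c n (+ a))
    S-values {a} (suc b) a<p 1+b<p = below , notBelow
      where
      b≤n : b ≤ n
      b≤n = ℕP.≤-pred (ℕP.≤-pred 1+b<p)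
      b<p : b < p
      b<p = ℕP.<-trans (ℕP.n<1+n b) 1+b<p
      previous : (a < b → S (+ a) (+ b) ≈ 1ℤ) × (b ≤ a → S (+ a) (+ b) ≈ 0ℤ)
      previous = S-values b a<p b<p
      below : a < suc b → S (+ a) (+ suc b) ≈ 1ℤ
      below (s≤s a≤b) with a ℕ.≟ b
      ... | yes ≡.refl = begin
        S (+ a) (+ suc a)                                 ≈⟨ S-step a b≤n ⟩
        S (+ a) (+ a) - riseFall (suc n) (+ a) (+ a)      ≈⟨ +-cong (proj₂ previous ℕP.≤-refl) (-‿cong (≈-trans (riseFall-diagonal a) wilson)) ⟩
        0ℤ - -1ℤ                                          ≡⟨⟩
        1ℤ                                                ∎
      ... | no a≢b = begin
        S (+ a) (+ suc b)                                 ≈⟨ S-step a b≤n ⟩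
        S (+ a) (+ b) - riseFall (suc n) (+ a) (+ b)
          ≈⟨ +-cong (proj₁ previous (ℕP.≤∧≢⇒< a≤b a≢b)) (-‿cong (riseFall-offDiagonal a<p b<p a≢b)) ⟩
        1ℤ - 0ℤ                                           ≡⟨⟩
        1ℤ                                                ∎
      notBelow : suc b ≤ a → S (+ a) (+ suc b) ≈ 0ℤ
      notBelow b<a = begin
        S (+ a) (+ suc b)                                 ≈⟨ S-step a b≤n ⟩
        S (+ a) (+ b) - riseFall (suc n) (+ a) (+ b)
          ≈⟨ +-cong (proj₂ previous (ℕP.<⇒≤ b<a)) (-‿cong (riseFall-offDiagonal a<p b<p (ℕP.>⇒≢ b<a))) ⟩
        0ℤ - 0ℤ                                           ≡⟨⟩
        0ℤ                                                ∎

    S≈1 : ∀ {a b} → a < b → b < p → S (+ a) (+ b) ≈ 1ℤ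
    S≈1 {a} {b} a<b b<p = proj₁ (S-values b (ℕP.<-trans a<b b<p) b<p) a<b

    S≈0 : ∀ {a b} → b ≤ a → a < p → S (+ a) (+ b) ≈ 0ℤ
    S≈0 {a} {b} b≤a a<p = proj₂ (S-values b a<p (ℕP.≤-<-trans b≤a a<p)) b≤a

    x+[y-x]*S≈x⊔y : ∀ {x y} → x < p → y < p → + x + (+ y - + x) * S (+ x) (+ y) ≈ + (x ⊔ y)
    x+[y-x]*S≈x⊔y {x} {y} x<p y<p with x ℕ.<? y
    ... | yes x<y = begin
      + x + (+ y - + x) * S (+ x) (+ y)   ≈⟨ +-cong (≈-refl {+ x}) (*-cong (≈-refl {+ y - + x}) (S≈1 x<y y<p)) ⟩
      + x + (+ y - + x) * 1ℤ              ≡⟨ x+[y-x]*1≡y (+ x) (+ y) ⟩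
      + y                                 ≡⟨ ≡.cong +_ (ℕP.m≤n⇒m⊔n≡n (ℕP.<⇒≤ x<y)) ⟨
      + (x ⊔ y)                           ∎
      where
      x+[y-x]*1≡y : ∀ x y → x + (y - x) * 1ℤ ≡ y
      x+[y-x]*1≡y = solve-∀
    ... | no x≮y = begin
      + x + (+ y - + x) * S (+ x) (+ y)   ≈⟨ +-cong (≈-refl {+ x}) (*-cong (≈-refl {+ y - + x}) (S≈0 (ℕP.≮⇒≥ x≮y) x<p)) ⟩
      + x + (+ y - + x) * 0ℤ              ≡⟨ x+[y-x]*0≡x (+ x) (+ y) ⟩
      + x                                 ≡⟨ ≡.cong +_ (ℕP.m≥n⇒m⊔n≡m (ℕP.≮⇒≥ x≮y)) ⟨
      + (x ⊔ y)                           ∎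
      where
      x+[y-x]*0≡x : ∀ x y → x + (y - x) * 0ℤ ≡ x
      x+[y-x]*0≡x = solve-∀

    fall-top : fall (+ (p ∸ 1)) (p ∸ 1) ≈ -1ℤ
    fall-top = ≈-trans (≈-reflexive (fall-diagonal (p ∸ 1))) wilson

    rise-bottom : rise 0ℤ (p ∸ 1) ≈ -1ℤ
    rise-bottom = ≈-trans (≈-reflexive (rise-0ℤ (p ∸ 1))) wilson

    p-1+1≈0 : + (p ∸ 1) + 1ℤ ≈ 0ℤ
    p-1+1≈0 = ≈-trans (≈-reflexive (≡.sym (pos-suc (p ∸ 1)))) P≈0

    p^[p-1]≈0 : (+ (p ∸ 1) + 1ℤ) ^ (p ∸ 1) ≈ 0ℤ
    p^[p-1]≈0 = ≈-trans (*-cong p-1+1≈0 (≈-refl {(+ (p ∸ 1) + 1ℤ) ^ n})) (≈-reflexive (ℤP.*-zeroˡ ((+ (p ∸ 1) + 1ℤ) ^ n)))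

    1-[y+1]^[p-1]≈-fall : ∀ {y} → y < p → 1ℤ - (+ y + 1ℤ) ^ (p ∸ 1) ≈ - fall (+ y) (p ∸ 1)
    1-[y+1]^[p-1]≈-fall {y} y<p with y ℕ.≟ p ∸ 1
    ... | yes ≡.refl = begin
      1ℤ - (+ (p ∸ 1) + 1ℤ) ^ (p ∸ 1)   ≈⟨ +-cong (≈-refl {1ℤ}) (-‿cong p^[p-1]≈0) ⟩
      1ℤ - 0ℤ                           ≡⟨⟩
      - -1ℤ                             ≈⟨ -‿cong (≈-sym fall-top) ⟩
      - fall (+ (p ∸ 1)) (p ∸ 1)        ∎
    ... | no y≢p-1 = begin
      1ℤ - (+ y + 1ℤ) ^ (p ∸ 1)         ≈⟨ +-cong (≈-refl {1ℤ}) (-‿cong [y+1]^[p-1]≈1) ⟩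
      1ℤ - 1ℤ                           ≡⟨⟩
      - 0ℤ                              ≡⟨ ≡.cong -_ (fall-vanish n y≤n) ⟨
      - fall (+ y) (p ∸ 1)              ∎
      where
      y<p-1 : y < p ∸ 1
      y<p-1 = ℕP.≤∧≢⇒< (ℕP.≤-pred y<p) y≢p-1
      y≤n : y ≤ n
      y≤n = ℕP.≤-pred y<p-1
      [y+1]^[p-1]≈1 : (+ y + 1ℤ) ^ (p ∸ 1) ≈ 1ℤ
      [y+1]^[p-1]≈1 = ≈-trans (≈-reflexive (≡.cong (_^ (p ∸ 1)) (≡.sym (pos-suc y)))) (fermat (s≤s z≤n) (s≤s y<p-1))

    1-x^[p-1]≈-rise : ∀ {x} → x < p → 1ℤ - (+ x) ^ (p ∸ 1) ≈ - rise (+ x) (p ∸ 1)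
    1-x^[p-1]≈-rise {zero}  _ = -‿cong (≈-sym rise-bottom)
    1-x^[p-1]≈-rise {suc x} x<p = begin
      1ℤ - (+ suc x) ^ (p ∸ 1)          ≈⟨ +-cong (≈-refl {1ℤ}) (-‿cong (fermat (s≤s z≤n) x<p)) ⟩
      - 0ℤ                              ≈⟨ -‿cong (≈-sym (rise-vanish (s≤s z≤n) x<p)) ⟩
      - rise (+ suc x) (p ∸ 1)          ∎

    [y+1]*fall≈0 : ∀ {y} → y < p → (+ y + 1ℤ) * fall (+ y) (p ∸ 1) ≈ 0ℤ
    [y+1]*fall≈0 {y} y<p with y ℕ.≟ p ∸ 1
    ... | yes ≡.refl = ≈-trans (*-cong p-1+1≈0 (≈-refl {fall (+ (p ∸ 1)) (p ∸ 1)})) (≈-reflexive (ℤP.*-zeroˡ (fall (+ (p ∸ 1)) (p ∸ 1))))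
    ... | no y≢p-1 = ≈-reflexive (≡.trans (≡.cong ((+ y + 1ℤ) *_) (fall-vanish n (ℕP.≤-pred (ℕP.≤∧≢⇒< (ℕP.≤-pred y<p) y≢p-1))))
                                          (ℤP.*-zeroʳ (+ y + 1ℤ)))

    x*rise≈0 : ∀ {x} → x < p → + x * rise (+ x) (p ∸ 1) ≈ 0ℤ
    x*rise≈0 {zero}  _   = ≈-refl
    x*rise≈0 {suc x} x<p = ≈-trans (*-cong (≈-refl {+ suc x}) (rise-vanish (s≤s z≤n) x<p)) (≈-reflexive (ℤP.*-zeroʳ (+ suc x)))


-- Evaluation and degrees of polynomial expressions

map-range : ∀ {A : Set} (F : ℕ → A) a b → map F (range a b) ≡ applyUpTo (λ i → F (a ℕ.+ i)) (suc b ∸ a)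
map-range F a b = ≡.trans (≡.cong (map F) (map-applyUpTo id (a ℕ.+_) (suc b ∸ a))) (map-applyUpTo (a ℕ.+_) F (suc b ∸ a))

module _ (x y : ℤ) where

  eval-ΣP : ∀ k (F : ℕ → Poly) → eval x y (ΣP (applyUpTo F k)) ≡ ∑[ i < k ] eval x y (F i)
  eval-ΣP zero    F = ≡.refl
  eval-ΣP (suc k) F = ≡.cong (_+_ (eval x y (F 0))) (eval-ΣP k (F ∘ suc))

  eval-ΠP : ∀ k (F : ℕ → Poly) → eval x y (ΠP (applyUpTo F k)) ≡ ∏[ i < k ] eval x y (F i)
  eval-ΠP zero    F = ≡.refl
  eval-ΠP (suc k) F = ≡.cong (eval x y (F 0) *_) (eval-ΠP k (F ∘ suc))

  eval-^^ : ∀ a k → eval x y (a ^^ k) ≡ eval x y a ^ k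
  eval-^^ a zero    = ≡.refl
  eval-^^ a (suc k) = ≡.cong (eval x y a *_) (eval-^^ a k)

module Degree (deg : Poly → ℕ)
              (deg-con : ∀ c → deg (con c) ≡ 0)
              (deg-⊕ : ∀ a b → deg (a ⊕ b) ≡ deg a ⊔ deg b)
              (deg-⊗ : ∀ a b → deg (a ⊗ b) ≡ deg a ℕ.+ deg b) where

  deg-ΣP : ∀ k (F : ℕ → Poly) {b} → (∀ i → i < k → deg (F i) ≤ b) → deg (ΣP (applyUpTo F k)) ≤ b
  deg-ΣP zero    F _   = ℕP.≤-trans (ℕP.≤-reflexive (deg-con 0ℤ)) z≤n
  deg-ΣP (suc k) F F≤b = ℕP.≤-trans (ℕP.≤-reflexive (deg-⊕ (F 0) _))
    (ℕP.⊔-lub (F≤b 0 (s≤s z≤n)) (deg-ΣP k (F ∘ suc) (λ i i<k → F≤b (suc i) (s≤s i<k))))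

  deg-ΠP : ∀ k (F : ℕ → Poly) {b} → (∀ i → deg (F i) ≤ b) → deg (ΠP (applyUpTo F k)) ≤ k ℕ.* b
  deg-ΠP zero    F _   = ℕP.≤-reflexive (deg-con 1ℤ)
  deg-ΠP (suc k) F F≤b = ℕP.≤-trans (ℕP.≤-reflexive (deg-⊗ (F 0) _)) (ℕP.+-mono-≤ (F≤b 0) (deg-ΠP k (F ∘ suc) (F≤b ∘ suc)))

  deg-^^ : ∀ a k → deg (a ^^ k) ≡ k ℕ.* deg a
  deg-^^ a zero    = deg-con 1ℤ
  deg-^^ a (suc k) = ≡.trans (deg-⊗ a (a ^^ k)) (≡.cong (deg a ℕ.+_) (deg-^^ a k))

module Deg₀ = Degree deg₀ (λ _ → ≡.refl) (λ _ _ → ≡.refl) (λ _ _ → ≡.refl)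
module Deg₁ = Degree deg₁ (λ _ → ≡.refl) (λ _ _ → ≡.refl) (λ _ _ → ≡.refl)

-- the where-bound summand of Defs.maxPoly, to which maxPoly p inv unfolds
summand : ℕ → (ℕ → ℤ) → ℕ → Poly
summand p inv d = con (inv d)
                ⊗ ΠP (map (λ i → X₀ ⊕ ı i) (range 1 d))
                ⊗ ΠP (map (λ i → X₁ ⊝ ı i) (upTo (p ∸ d)))

eval-summand : ∀ x y p inv d → eval x y (summand p inv d) ≡ inv d * rise x d * fall y (p ∸ d)
eval-summand x y p inv d = ≡.cong₂ (λ r f → inv d * r * f)
  (≡.trans (≡.cong (eval x y ∘ ΠP) (map-range (λ i → X₀ ⊕ ı i) 1 d)) (eval-ΠP x y d (λ i → X₀ ⊕ ı (suc i))))
  (≡.trans (≡.cong (eval x y ∘ ΠP) (map-applyUpTo id (λ i → X₁ ⊝ ı i) (p ∸ d))) (eval-ΠP x y (p ∸ d) (λ i → X₁ ⊝ ı i)))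

summand-deg₀ : ∀ p inv d → deg₀ (summand p inv d) ≤ d
summand-deg₀ p inv d = ℕP.≤-trans
  (ℕP.+-mono-≤ (ℕP.≤-trans (ℕP.≤-reflexive (≡.cong (deg₀ ∘ ΠP) (map-range (λ i → X₀ ⊕ ı i) 1 d)))
                            (Deg₀.deg-ΠP d (λ i → X₀ ⊕ ı (suc i)) (λ _ → ℕP.≤-refl)))
               (ℕP.≤-trans (ℕP.≤-reflexive (≡.cong (deg₀ ∘ ΠP) (map-applyUpTo id (λ i → X₁ ⊝ ı i) (p ∸ d))))
                            (Deg₀.deg-ΠP (p ∸ d) (λ i → X₁ ⊝ ı i) (λ _ → z≤n))))
  (ℕP.≤-reflexive (≡.trans (≡.cong₂ ℕ._+_ (ℕP.*-identityʳ d) (ℕP.*-zeroʳ (p ∸ d))) (ℕP.+-identityʳ d)))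

summand-deg₁ : ∀ p inv d → deg₁ (summand p inv d) ≤ p ∸ d
summand-deg₁ p inv d = ℕP.≤-trans
  (ℕP.+-mono-≤ (ℕP.≤-trans (ℕP.≤-reflexive (≡.cong (deg₁ ∘ ΠP) (map-range (λ i → X₀ ⊕ ı i) 1 d)))
                            (Deg₁.deg-ΠP d (λ i → X₀ ⊕ ı (suc i)) (λ _ → z≤n)))
               (ℕP.≤-trans (ℕP.≤-reflexive (≡.cong (deg₁ ∘ ΠP) (map-applyUpTo id (λ i → X₁ ⊝ ı i) (p ∸ d))))
                            (Deg₁.deg-ΠP (p ∸ d) (λ i → X₁ ⊝ ı i) (λ _ → ℕP.≤-refl))))
  (ℕP.≤-reflexive (≡.cong₂ ℕ._+_ (ℕP.*-zeroʳ d) (ℕP.*-identityʳ (p ∸ d))))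

module _ (m : ℕ) (inv : ℕ → ℤ) where

  private
    p : ℕ
    p = 3 ℕ.+ m

  summands-deg₀ : deg₀ (ΣP (map (summand p inv) (range 2 (p ∸ 2)))) ≤ suc m
  summands-deg₀ = ℕP.≤-trans (ℕP.≤-reflexive (≡.cong (deg₀ ∘ ΣP) (map-range (summand p inv) 2 (p ∸ 2))))
    (Deg₀.deg-ΣP m (λ i → summand p inv (2 ℕ.+ i)) (λ i i<m → ℕP.≤-trans (summand-deg₀ p inv (2 ℕ.+ i)) (s≤s i<m)))

  summands-deg₁ : deg₁ (ΣP (map (summand p inv) (range 2 (p ∸ 2)))) ≤ suc m
  summands-deg₁ = ℕP.≤-trans (ℕP.≤-reflexive (≡.cong (deg₁ ∘ ΣP) (map-range (summand p inv) 2 (p ∸ 2))))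
    (Deg₁.deg-ΣP m (λ i → summand p inv (2 ℕ.+ i)) (λ i _ → ℕP.≤-trans (summand-deg₁ p inv (2 ℕ.+ i)) (ℕP.m∸n≤m (suc m) i)))

  maxPoly-deg₀ : deg₀ (maxPoly p inv) ≤ p ∸ 1
  maxPoly-deg₀ = ℕP.⊔-lub (ℕP.⊔-lub (ℕP.⊔-lub (s≤s summands-deg₀) (s≤s z≤n)) second) third
    where
    second : 2 ℕ.+ deg₀ ((X₁ ⊕ ı 1) ^^ (p ∸ 1)) ≤ p ∸ 1
    second = ℕP.≤-trans (ℕP.≤-reflexive (≡.cong (2 ℕ.+_) (≡.trans (Deg₀.deg-^^ (X₁ ⊕ ı 1) (p ∸ 1)) (ℕP.*-zeroʳ (p ∸ 1)))))
                        (s≤s (s≤s z≤n))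
    third : deg₀ (X₀ ^^ (p ∸ 1)) ℕ.+ 0 ≤ p ∸ 1
    third = ℕP.≤-reflexive (≡.trans (ℕP.+-identityʳ _) (≡.trans (Deg₀.deg-^^ X₀ (p ∸ 1)) (ℕP.*-identityʳ (p ∸ 1))))

  maxPoly-deg₁ : deg₁ (maxPoly p inv) ≤ p ∸ 1
  maxPoly-deg₁ = ℕP.⊔-lub (ℕP.⊔-lub (ℕP.⊔-lub (s≤s summands-deg₁) z≤n) second) third
    where
    second : deg₁ ((X₁ ⊕ ı 1) ^^ (p ∸ 1)) ≤ p ∸ 1
    second = ℕP.≤-reflexive (≡.trans (Deg₁.deg-^^ (X₁ ⊕ ı 1) (p ∸ 1)) (ℕP.*-identityʳ (p ∸ 1)))
    third : deg₁ (X₀ ^^ (p ∸ 1)) ℕ.+ 2 ≤ p ∸ 1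
    third = ℕP.≤-trans (ℕP.≤-reflexive (≡.cong (ℕ._+ 2) (≡.trans (Deg₁.deg-^^ X₀ (p ∸ 1)) (ℕP.*-zeroʳ (p ∸ 1))))) (s≤s (s≤s z≤n))

-- 1ℤ * ((x + 1ℤ) * 1ℤ) and (y - 0ℤ) * 1ℤ are rise x 1 and fall y 1 unfolded
maxPoly-regroup : ∀ x y M f r u v →
  (y - x) * M + x + (x + 1ℤ) * ((x + 1ℤ) * 1ℤ) * (1ℤ - u) + (1ℤ - v) * (y * (y * 1ℤ)) ≡
  (y - x) * ((1ℤ * ((x + 1ℤ) * 1ℤ) * f + M + - 1ℤ * r * ((y - 0ℤ) * 1ℤ)) - (x + 1ℤ) * f + r * y)
    + x + (x + 1ℤ) * (x + 1ℤ) * (1ℤ - u) + (1ℤ - v) * (y * y)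
maxPoly-regroup = solve-∀

maxPoly-rearrange : ∀ x y s f r →
  (y - x) * (s - (x + 1ℤ) * f + r * y) + x + (x + 1ℤ) * (x + 1ℤ) * (- f) + (- r) * (y * y) ≡
  x + (y - x) * s - (x + 1ℤ) * ((y + 1ℤ) * f) - y * (x * r)
maxPoly-rearrange = solve-∀

module Coefficients (m : ℕ) (inv : ℕ → ℤ) where

  open ≡.≡-Reasoning

  p : ℕ
  p = 3 ℕ.+ m

  -- inv extended by 1⁻¹ = 1 and (p − 1)⁻¹ = −1
  c : ℕ → ℤ
  c (suc zero) = 1ℤ
  c d with d ℕ.≟ suc (suc m)
  ... | yes _ = -1ℤ
  ... | no _  = inv d

  c-top : c (suc (suc m)) ≡ -1ℤ
  c-top with suc (suc m) ℕ.≟ suc (suc m)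
  ... | yes _ = ≡.refl
  ... | no ≢  = ⊥-elim (≢ ≡.refl)

  c-mid : ∀ {i} → i < m → c (2 ℕ.+ i) ≡ inv (2 ℕ.+ i)
  c-mid {i} i<m with 2 ℕ.+ i ℕ.≟ suc (suc m)
  ... | yes 2+i≡2+m = ⊥-elim (ℕP.<⇒≢ i<m (ℕP.suc-injective (ℕP.suc-injective 2+i≡2+m)))
  ... | no _        = ≡.refl

  S : ℤ → ℤ → ℤ
  S = weightedRiseFall c (suc m)

  summands : ℤ → ℤ → ℤ
  summands x y = ∑[ i < m ] inv (2 ℕ.+ i) * rise x (2 ℕ.+ i) * fall y (3 ℕ.+ m ∸ (2 ℕ.+ i))

  S-decomposition : ∀ x y → S x y ≡ 1ℤ * rise x 1 * fall y (suc (suc m)) + summands x y + -1ℤ * rise x (suc (suc m)) * fall y 1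
  S-decomposition x y = ≡.trans (≡.cong (_+_ first) (≡.trans (∑.snoc m (λ d → g (suc d) (m ∸ d))) (≡.cong₂ _+_ middle last)))
                                (≡.sym (ℤP.+-assoc first (summands x y) _))
    where
    g : ℕ → ℕ → ℤ
    g d e = c (suc d) * rise x (suc d) * fall y (suc e)
    first : ℤ
    first = g 0 (suc m)
    middle : ∑[ i < m ] g (suc i) (m ∸ i) ≡ summands x y
    middle = ∑.cong-< m (λ i i<m → ≡.cong₂ (λ a e → a * rise x (2 ℕ.+ i) * fall y e) (c-mid i<m) (≡.sym (ℕP.+-∸-assoc 1 (ℕP.<⇒≤ i<m))))
    last : g (suc m) (m ∸ m) ≡ -1ℤ * rise x (suc (suc m)) * fall y 1
    last = ≡.cong₂ (λ a e → a * rise x (suc (suc m)) * fall y (suc e)) c-top (ℕP.n∸n≡0 m)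

  maxPoly-eval : ∀ x y → eval x y (maxPoly p inv) ≡
                 (y - x) * (S x y - (x + 1ℤ) * fall y (p ∸ 1) + rise x (p ∸ 1) * y)
                   + x + (x + 1ℤ) * (x + 1ℤ) * (1ℤ - (y + 1ℤ) ^ (p ∸ 1)) + (1ℤ - x ^ (p ∸ 1)) * (y * y)
  maxPoly-eval x y = begin
    eval x y (maxPoly p inv)
      ≡⟨ ≡.cong₂ (λ M r → E M r (eval x y (X₀ ^^ (p ∸ 1)))) eval-summands (eval-^^ x y (X₁ ⊕ ı 1) (p ∸ 1)) ⟩
    E (summands x y) ((y + 1ℤ) ^ (p ∸ 1)) (eval x y (X₀ ^^ (p ∸ 1)))
      ≡⟨ ≡.cong (E (summands x y) ((y + 1ℤ) ^ (p ∸ 1))) (eval-^^ x y X₀ (p ∸ 1)) ⟩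
    E (summands x y) ((y + 1ℤ) ^ (p ∸ 1)) (x ^ (p ∸ 1))
      ≡⟨ maxPoly-regroup x y (summands x y) (fall y (p ∸ 1)) (rise x (p ∸ 1)) ((y + 1ℤ) ^ (p ∸ 1)) (x ^ (p ∸ 1)) ⟩
    (y - x) * (S′ - (x + 1ℤ) * fall y (p ∸ 1) + rise x (p ∸ 1) * y) + x + T₂ + T₃
      ≡⟨ ≡.cong (λ s → (y - x) * (s - (x + 1ℤ) * fall y (p ∸ 1) + rise x (p ∸ 1) * y) + x + T₂ + T₃) (S-decomposition x y) ⟨
    (y - x) * (S x y - (x + 1ℤ) * fall y (p ∸ 1) + rise x (p ∸ 1) * y) + x + T₂ + T₃
      ∎
    where
    S′ T₂ T₃ : ℤ
    S′ = 1ℤ * rise x 1 * fall y (p ∸ 1) + summands x y + -1ℤ * rise x (p ∸ 1) * fall y 1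
    T₂ = (x + 1ℤ) * (x + 1ℤ) * (1ℤ - (y + 1ℤ) ^ (p ∸ 1))
    T₃ = (1ℤ - x ^ (p ∸ 1)) * (y * y)
    E : ℤ → ℤ → ℤ → ℤ
    E M u v = (y - x) * M + x + (x + 1ℤ) * ((x + 1ℤ) * 1ℤ) * (1ℤ - u) + (1ℤ - v) * (y * (y * 1ℤ))
    eval-summands : eval x y (ΣP (map (summand p inv) (range 2 (p ∸ 2)))) ≡ summands x y
    eval-summands = ≡.trans (≡.cong (eval x y ∘ ΣP) (map-range (summand p inv) 2 (p ∸ 2)))
                   (≡.trans (eval-ΣP x y m (λ i → summand p inv (2 ℕ.+ i))) (∑.cong-< m (λ i _ → eval-summand x y p inv (2 ℕ.+ i))))

module MaxPolyValue (m : ℕ) (p-prime : Prime (3 ℕ.+ m)) (inv : ℕ → ℤ) where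

  open PrimeModulus (suc m) p-prime
  open Coefficients m inv using (c; c-top; c-mid; maxPoly-eval)
  open import Relation.Binary.Reasoning.Setoid setoid

  module _ (inv-correct : ∀ {d} → 2 ≤ d → d ≤ suc m → + d * inv d ≈ 1ℤ) where

    c-inverse : ∀ {d} → d ≤ suc m → + suc d * c (suc d) ≈ 1ℤ
    c-inverse {zero}  _ = ≈-refl
    c-inverse {suc k} 1+k≤1+m with suc k ℕ.≟ suc m
    ... | yes ≡.refl = begin
      + suc (suc m) * c (suc (suc m))  ≡⟨ ≡.cong (+ suc (suc m) *_) c-top ⟩
      + suc (suc m) * -1ℤ              ≈⟨ *-cong p-1≈-1 (≈-refl { -1ℤ}) ⟩
      -1ℤ * -1ℤ                        ≡⟨⟩
      1ℤ                               ∎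
    ... | no k≢m = ≈-trans (≈-reflexive (≡.cong (+ suc (suc k) *_) (c-mid k<m))) (inv-correct (s≤s (s≤s z≤n)) (s≤s k<m))
      where
      k<m : k < m
      k<m = ℕP.≤∧≢⇒< (ℕP.≤-pred 1+k≤1+m) (k≢m ∘ ≡.cong suc)

    open WithInverses c c-inverse

    maxPoly≈max : ∀ {x y} → x < p → y < p → eval (+ x) (+ y) (maxPoly p inv) ≈ + (x ⊔ y)
    maxPoly≈max {x} {y} x<p y<p = begin
      eval X Y (maxPoly p inv)
        ≡⟨ maxPoly-eval X Y ⟩
      (Y - X) * (S X Y - (X + 1ℤ) * f + r * Y) + X + (X + 1ℤ) * (X + 1ℤ) * (1ℤ - (Y + 1ℤ) ^ (p ∸ 1)) + (1ℤ - X ^ (p ∸ 1)) * (Y * Y)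
        ≈⟨ +-cong (+-cong (≈-refl {(Y - X) * (S X Y - (X + 1ℤ) * f + r * Y) + X}) (*-cong (≈-refl {(X + 1ℤ) * (X + 1ℤ)}) (1-[y+1]^[p-1]≈-fall y<p)))
                  (*-cong (1-x^[p-1]≈-rise x<p) (≈-refl {Y * Y})) ⟩
      (Y - X) * (S X Y - (X + 1ℤ) * f + r * Y) + X + (X + 1ℤ) * (X + 1ℤ) * (- f) + (- r) * (Y * Y)
        ≡⟨ maxPoly-rearrange X Y (S X Y) f r ⟩
      X + (Y - X) * S X Y - (X + 1ℤ) * ((Y + 1ℤ) * f) - Y * (X * r)
        ≈⟨ +-cong (+-cong (≈-refl {X + (Y - X) * S X Y}) (-‿cong (*-cong (≈-refl {X + 1ℤ}) ([y+1]*fall≈0 y<p))))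
                  (-‿cong (*-cong (≈-refl {Y}) (x*rise≈0 x<p))) ⟩
      X + (Y - X) * S X Y - (X + 1ℤ) * 0ℤ - Y * 0ℤ
        ≡⟨ ≡.cong₂ (λ u v → X + (Y - X) * S X Y - u - v) (ℤP.*-zeroʳ (X + 1ℤ)) (ℤP.*-zeroʳ Y) ⟩
      X + (Y - X) * S X Y - 0ℤ - 0ℤ
        ≡⟨ ≡.trans (ℤP.+-identityʳ _) (ℤP.+-identityʳ _) ⟩
      X + (Y - X) * S X Y
        ≈⟨ x+[y-x]*S≈x⊔y x<p y<p ⟩
      + (x ⊔ y) ∎
      where
      X Y f r : ℤ
      X = + x
      Y = + y
      f = fall Y (p ∸ 1)
      r = rise X (p ∸ 1)

theorem5p5 : (p : ℕ) → Prime p → 3 ≤ p →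
    (inv : ℕ → ℤ) →
    (∀ d → 2 ≤ d → d ≤ p ∸ 2 → (+ p) ∣ ((+ d ℤ.* inv d) - + 1)) →
    (deg₀ (maxPoly p inv) ≤ p ∸ 1) × (deg₁ (maxPoly p inv) ≤ p ∸ 1) ×
    ((x₀ x₁ : ℕ) → x₀ < p → x₁ < p →
      (+ p) ∣ (eval (+ x₀) (+ x₁) (maxPoly p inv) - + (x₀ ⊔ x₁)))
theorem5p5 (suc (suc ℕ.zero)) _ (s≤s (s≤s ())) _ _
theorem5p5 (suc (suc (suc m))) p-prime _ inv inv-correct =
  maxPoly-deg₀ m inv , maxPoly-deg₁ m inv ,
  λ x₀ x₁ x₀<p x₁<p → Signed.∣⇒∣ᵤ (divides (maxPoly≈max inverses x₀<p x₁<p))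
  where
  open MaxPolyValue m p-prime inv
  open Modulo (+ (3 ℕ.+ m)) using (_≈_; mod; divides)
  inverses : ∀ {d} → 2 ≤ d → d ≤ suc m → + d ℤ.* inv d ≈ 1ℤ
  inverses {d} 2≤d d≤1+m = mod (Signed.∣ᵤ⇒∣ (inv-correct d 2≤d d≤1+m))
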